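{- Let $n\geqslant 1$. The map $(T,e)\mapsto \mathrm{insertion}(T,e)$ is a bijection from the set of pairs $(T,e)$, where $T$ is a staircase tableau of size $n$ and $e$ is an element of $\{\alpha,\beta,\gamma,\delta\}\cup\{(x,y,i)\mid x\in\{\alpha,\gamma\},\ y\in\{\beta,\delta\},\ i\in\{1,\dots,n\}\}$, onto the set of staircase tableaux of size $n+1$.
   Context: Staircase tableaux. For $n\geqslant 1$, the staircase shape of size $n$ is the set of cells $(i,j)$ with $1\leqslant j\leqslant i\leqslant n$ ($i$ = row, $j$ = column), rows numbered from bottom to top and columns from left to right; thus row $i$ consists of $(i,1),\dots,(i,i)$ (the top row $n$ is the longest), column $j$ consists of $(j,j),(j+1,j),\dots,(n,j)$ from bottom to top, and the diagonal cells are $c_i=(i,i)$. A staircase tableau of size $n$ is a filling of this shape in which every cell is either empty or labelled by one of the symbols $\alpha,\beta,\gamma,\delta$, such that: every diagonal cell $c_i$ is labelled; if a cell $(i,j)$ is labelled $\alpha$ or $\gamma$, then all cells $(i',j)$ with $i'>i$ (above it in its column) are empty; if a cell $(i,j)$ is labelled $\beta$ or $\delta$, then all cells $(i,j')$ with $j'<j$ (to its left in its row) are empty. Row $i$ is "of type $\alpha/\gamma$" if $c_i$ is labelled $\alpha$ or $\gamma$. Elementary operations. For rows $i_1<i_2$: if all cells of row $i_2$ are empty, the operation $L_{i_1}\to L_{i_2}$ moves the content of cell $(i_1,k)$ to cell $(i_2,k)$ for every $1\leqslant k\leqslant i_1$ (leaving $(i_1,k)$ empty); if all cells of row $i_2$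 except $c_{i_2}$ are empty, the operation $L^*_{i_1}\to L_{i_2}$ does the same for every $1\leqslant k<i_1$ only. Insertion. Let $T$ be a staircase tableau of size $n$. Adding a row $L_{n+1}(z)$ means adding above $T$ a new row $n+1$ of cells $(n+1,1),\dots,(n+1,n+1)$, all empty except $c_{n+1}$, which is labelled $z$. (1) For $y\in\{\beta,\delta\}$: $\mathrm{insertion}(T,y)$ is $T$ with the row $L_{n+1}(y)$ added. (2) For $x\in\{\alpha,\gamma\}$: add the row $L_{n+1}(x)$; let $i_1<\dots<i_k=n+1$ be the indices of all rows of type $\alpha/\gamma$ of the resulting array; perform successively $L^*_{i_{k-1}}\to L_{i_k}$, then $L^*_{i_{k-2}}\to L_{i_{k-1}}$, ..., then $L^*_{i_1}\to L_{i_2}$. The result is $\mathrm{insertion}(T,x)$. (3) For $x\in\{\alpha,\gamma\}$, $y\in\{\beta,\delta\}$, $i\in\{1,\dots,n\}$: add the row $L_{n+1}(x)$; let $i<i_l<\dots<i_k=n+1$ be the indices of the rows of type $\alpha/\gamma$ that are strictly above row $i$; perform successively $L^*_{i_{k-1}}\to L_{i_k}$, ..., $L^*_{i_l}\to L_{i_{l+1}}$ (nothing if $l=k$); then perform $L_i\to L_{i_l}$; finally label the (now empty) cell $c_i$ with $y$. The result is $\mathrm{insertion}(T,(x,y,i))$. -}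

module Defs where

open import Data.Nat using (ℕ; zero; suc; _≤_; _<_; _≡ᵇ_; _<ᵇ_; _∸_)
open import Data.Bool using (Bool; true; false; if_then_else_; _∧_)
open import Data.Maybe using (Maybe; just; nothing)
open import Data.Unit using (⊤; tt)
open import Data.Empty using (⊥)
open import Data.Product using (_×_; _,_; Σ; ∃)
open import Data.List using (List; []; _∷_; filter; upTo; map)
open import Data.Vec using (Vec; lookup; tabulate)
open import Data.Fin using (Fin; toℕ)
open import Relation.Binary.PropositionalEquality using (_≡_)

data Sym : Set where
  α β γ δ : Sym

data AG : Set where
  αₓ γₓ : AG

data BD : Set where
  βᵧ δᵧ : BD

agSym : AG → Sym
agSym αₓ = α
agSym γₓ = γ

bdSym : BD → Sym
bdSym βᵧ = β
bdSym δᵧ = δ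

isAG : Sym → Bool
isAG α = true
isAG γ = true
isAG β = false
isAG δ = false

Cell : Set
Cell = Maybe Sym

-- Fillings of the staircase shape of size n.
-- Filling (suc n) = (filling of rows 1..n) × (top row n+1, cells (n+1,1) .. (n+1,n+1)),
-- the k-th entry (0-based) of a row vector being column k+1.

Filling : ℕ → Set
Filling zero    = ⊤
Filling (suc n) = Filling n × Vec Cell (suc n)

-- Cell contents as a function of 1-based (row, column); `nothing` outside the shape.
get : {n : ℕ} → Filling n → ℕ → ℕ → Cell
get {zero}  _       i j = nothing
get {suc n} (T , r) i j =
  if i ≡ᵇ suc n
  then go j
  else get T i j
  where
  go : ℕ → Cell
  go zero    = nothing
  go (suc k) = lookupℕ r k
    where
    lookupℕ : {m : ℕ} → Vec Cell m → ℕ → Cell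
    lookupℕ Vec.[] _ = nothing
    lookupℕ (x Vec.∷ xs) zero = x
    lookupℕ (x Vec.∷ xs) (suc k) = lookupℕ xs k

build : (n : ℕ) → (ℕ → ℕ → Cell) → Filling n
build zero    f = tt
build (suc n) f = build n f , tabulate (λ k → f (suc n) (suc (toℕ k)))

isAGCell : Cell → Bool
isAGCell (just s) = isAG s
isAGCell nothing  = false

data IsAGLabel : Cell → Set where
  isα : IsAGLabel (just α)
  isγ : IsAGLabel (just γ)

data IsBDLabel : Cell → Set where
  isβ : IsBDLabel (just β)
  isδ : IsBDLabel (just δ)

record IsStaircase (n : ℕ) (T : Filling n) : Set where
  field
    diagLabelled : ∀ i → 1 ≤ i → i ≤ n → get T i i ≡ nothing → ⊥
    agColumn : ∀ i j → 1 ≤ j → j ≤ i → i ≤ n → IsAGLabel (get T i j) →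
               ∀ i' → i < i' → i' ≤ n → get T i' j ≡ nothing
    bdRow    : ∀ i j → 1 ≤ j → j ≤ i → i ≤ n → IsBDLabel (get T i j) →
               ∀ j' → 1 ≤ j' → j' < j → get T i j' ≡ nothing

-- Elementary operations on cell functions (1-based indices).
-- moveL  i₁ i₂ : L_{i₁} → L_{i₂}   (moves columns 1 .. i₁)
-- moveL* i₁ i₂ : L*_{i₁} → L_{i₂}  (moves columns 1 .. i₁ - 1)
-- They are applied only when their emptiness preconditions hold (which is the
-- case during insertion into a staircase tableau); they are defined as plain
-- "move the contents" operations.

CellFun : Set
CellFun = ℕ → ℕ → Cell

moveUpTo : ℕ → ℕ → ℕ → CellFun → CellFun
moveUpTo m i₁ i₂ f i j =
  if (0 <ᵇ j) ∧ (j <ᵇ suc m)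
  then (if i ≡ᵇ i₂ then f i₁ j else if i ≡ᵇ i₁ then nothing else f i j)
  else f i j

moveL : ℕ → ℕ → CellFun → CellFun
moveL i₁ i₂ = moveUpTo i₁ i₁ i₂

moveL* : ℕ → ℕ → CellFun → CellFun
moveL* i₁ i₂ = moveUpTo (i₁ ∸ 1) i₁ i₂

-- For an increasing list i₁ < ... < i_k, perform successively
-- L*_{i_{k-1}} → L_{i_k}, then ..., then L*_{i₁} → L_{i₂}.
chain : List ℕ → CellFun → CellFun
chain (a ∷ b ∷ rest) f = moveL* a b (chain (b ∷ rest) f)
chain _              f = f

addRow : ℕ → Sym → CellFun → CellFun
addRow n z f i j =
  if i ≡ᵇ suc n
  then (if j ≡ᵇ suc n then just z else nothing)
  else f i j

setDiag : ℕ → Sym → CellFun → CellFun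
setDiag i₀ y f i j = if (i ≡ᵇ i₀) ∧ (j ≡ᵇ i₀) then just y else f i j

agRows : ℕ → CellFun → List ℕ
agRows N f = filter (λ r → Data.Bool._≟_ (isAGCell (f r r)) true) (map suc (upTo N))
  where import Data.Bool

agRowsAbove : ℕ → ℕ → CellFun → List ℕ
agRowsAbove i N f = filter (λ r → Data.Nat._<?_ i r) (agRows N f)
  where import Data.Nat

-- e ∈ {α,β,γ,δ} ∪ {(x,y,i) | x ∈ {α,γ}, y ∈ {β,δ}, i ∈ {1..n}};
-- `triple x y i` stands for (x, y, toℕ i + 1).
data Elem (n : ℕ) : Set where
  letter : Sym → Elem n
  triple : AG → BD → Fin n → Elem n

headOr : ℕ → List ℕ → ℕ
headOr d []      = d
headOr d (x ∷ _) = x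

insertionFun : (n : ℕ) → CellFun → Elem n → CellFun
insertionFun n f (letter β) = addRow n β f
insertionFun n f (letter δ) = addRow n δ f
insertionFun n f (letter α) = let g = addRow n α f in chain (agRows (suc n) g) g
insertionFun n f (letter γ) = let g = addRow n γ f in chain (agRows (suc n) g) g
insertionFun n f (triple x y k) =
  let i   = suc (toℕ k)
      g   = addRow n (agSym x) f
      rs  = agRowsAbove i (suc n) g
      il  = headOr (suc n) rs
  in setDiag i (bdSym y) (moveL i il (chain rs g))

insertion : {n : ℕ} → Filling n → Elem n → Filling (suc n)
insertion {n} T e = build (suc n) (insertionFun n (get T) e)

-- Unfolding the chain of moves L*_{i_{k-1}} → L_{i_k}, …
--   gives a pointwise description (InsertionShape): rows below the inserted row i
--   and rows not of type α/γ are untouched; row i becomes empty except for y on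
--   its diagonal; every α/γ row r above i keeps its diagonal, receives in the
--   columns left of prev(r) the contents of the previous α/γ row prev(r), and is
--   empty from column prev(r) on.  The first α/γ row above i receives row i.
-- * Preservation.  If the top diagonal is β/δ the inverse
--   deletes the top row.  Otherwise the highest α/γ row with a label at or right
--   of the column of the previous α/γ row ("overhang") locates the inserted row i
--   (the column of its last label), and moving every α/γ row back down undoes the
--   chain.
module Submission where

open import Defs
open import Data.Nat using (ℕ; zero; suc; _≤_; _<_; _≡ᵇ_; _<ᵇ_; _≤ᵇ_; _∸_; z≤n; s≤s; pred; _≟_; _<?_; _≤?_)
open import Data.Nat.Properties
open import Data.Bool using (Bool; true; false; if_then_else_; _∧_; T)
open import Data.Bool.Properties using (∧-zeroʳ; ∧-identityʳ) renaming (_≟_ to _≟-Bool_)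
open import Data.Maybe using (just; nothing)
open import Data.Unit using (tt)
open import Data.Empty using (⊥; ⊥-elim)
open import Data.Product using (_×_; _,_; Σ; proj₁; proj₂)
open import Data.Sum using (_⊎_; inj₁; inj₂)
open import Data.List using (List; []; _∷_; _++_; filter; upTo; map)
open import Data.List.Properties using (filter-++; map-++; upTo-∷ʳ; ++-identityʳ)
open import Data.Vec using (Vec; tabulate; lookup)
open import Data.Vec.Properties using (tabulate-cong; tabulate∘lookup)
open import Data.Fin using (Fin; toℕ)
open import Data.Fin.Properties using (toℕ<n; toℕ≤pred[n])
open import Relation.Binary.PropositionalEquality
open import Relation.Nullary using (¬_; Dec; does; yes; no)
open import Relation.Binary.Definitions using (tri<; tri≈; tri>)

true≢false : true ≢ false
true≢false ()

≡ᵇ-refl : ∀ n → (n ≡ᵇ n) ≡ true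
≡ᵇ-refl zero = refl
≡ᵇ-refl (suc n) = ≡ᵇ-refl n

≡ᵇ-≢ : ∀ m n → m ≢ n → (m ≡ᵇ n) ≡ false
≡ᵇ-≢ m n m≢n with m ≡ᵇ n in eq
... | false = refl
... | true = ⊥-elim (m≢n (≡ᵇ⇒≡ m n (subst T (sym eq) tt)))

<ᵇ-< : ∀ {m n} → m < n → (m <ᵇ n) ≡ true
<ᵇ-< {zero} {suc n} _ = refl
<ᵇ-< {suc m} {suc n} (s≤s m<n) = <ᵇ-< m<n

<ᵇ-≮ : ∀ {m n} → ¬ m < n → (m <ᵇ n) ≡ false
<ᵇ-≮ {m} {n} m≮n with m <ᵇ n in eq
... | false = refl
... | true = ⊥-elim (m≮n (<ᵇ⇒< m n (subst T (sym eq) tt)))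

<ᵇ-≥ : ∀ {m n} → n ≤ m → (m <ᵇ n) ≡ false
<ᵇ-≥ n≤m = <ᵇ-≮ (≤⇒≯ n≤m)

<ᵇ⇒<′ : ∀ m n → (m <ᵇ n) ≡ true → m < n
<ᵇ⇒<′ m n eq = <ᵇ⇒< m n (subst T (sym eq) tt)

≤ᵇ-≤ : ∀ {m n} → m ≤ n → (m ≤ᵇ n) ≡ true
≤ᵇ-≤ {zero} _ = refl
≤ᵇ-≤ {suc m} m≤n = <ᵇ-< m≤n

≤ᵇ-> : ∀ {m n} → n < m → (m ≤ᵇ n) ≡ false
≤ᵇ-> {suc m} (s≤s n≤m) = <ᵇ-≥ n≤m

≤pred⇒< : ∀ {a b} → a ≤ pred b → 1 ≤ b → a < b
≤pred⇒< {a} {suc b} a≤b _ = s≤s a≤b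

suc-pred′ : ∀ k → 1 ≤ k → suc (pred k) ≡ k
suc-pred′ (suc k) _ = refl

rowAt : ∀ {m} → Vec Cell m → ℕ → Cell
rowAt v zero = nothing
rowAt Vec.[] (suc k) = nothing
rowAt (x Vec.∷ v) (suc zero) = x
rowAt (x Vec.∷ v) (suc (suc k)) = rowAt v (suc k)

get-top : ∀ n (T₀ : Filling n) (v : Vec Cell (suc n)) c → get {suc n} (T₀ , v) (suc n) c ≡ rowAt v c
get-top n T₀ v zero rewrite ≡ᵇ-refl n = refl
get-top n T₀ (x Vec.∷ v) (suc zero) rewrite ≡ᵇ-refl n = refl
get-top zero T₀ (x Vec.∷ Vec.[]) (suc (suc k)) = refl
get-top (suc m) T₀ (x Vec.∷ v) (suc (suc k)) = trans (dropFirst (proj₁ T₀)) (get-top m (proj₁ T₀) v (suc k))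
  where
  dropFirst : (T₁ : Filling m) →
    get {suc (suc m)} (T₀ , x Vec.∷ v) (suc (suc m)) (suc (suc k)) ≡ get {suc m} (T₁ , v) (suc m) (suc k)
  dropFirst T₁ rewrite ≡ᵇ-refl m = refl

get-low : ∀ n (T₀ : Filling n) v r c → r ≢ suc n → get {suc n} (T₀ , v) r c ≡ get T₀ r c
get-low n T₀ v r c r≢ rewrite ≡ᵇ-≢ r (suc n) r≢ = refl

rowAt-tabulate : ∀ m (F : ℕ → Cell) c → 1 ≤ c → c ≤ m → rowAt (tabulate {n = m} (λ k → F (suc (toℕ k)))) c ≡ F c
rowAt-tabulate (suc m) F (suc zero) _ _ = refl
rowAt-tabulate (suc m) F (suc (suc k)) _ (s≤s c≤m) = rowAt-tabulate m (λ c → F (suc c)) (suc k) (s≤s z≤n) c≤m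

rowAt-lookup : ∀ m (v : Vec Cell m) (k : Fin m) → rowAt v (suc (toℕ k)) ≡ lookup v k
rowAt-lookup (suc m) (x Vec.∷ v) Fin.zero = refl
rowAt-lookup (suc m) (x Vec.∷ v) (Fin.suc k) = rowAt-lookup m v k

get-build : ∀ n f r c → 1 ≤ c → c ≤ r → r ≤ n → get (build n f) r c ≡ f r c
get-build zero f r c 1≤c c≤r r≤n with ≤-trans 1≤c (≤-trans c≤r r≤n)
... | ()
get-build (suc n) f r c 1≤c c≤r r≤n with r ≟ suc n
... | yes refl = trans (get-top n (build n f) _ c) (rowAt-tabulate (suc n) (f (suc n)) c 1≤c c≤r)
... | no r≢ = trans (get-low n (build n f) _ r c r≢) (get-build n f r c 1≤c c≤r (≤-pred (≤∧≢⇒< r≤n r≢)))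

build-cong : ∀ n f g → (∀ r c → 1 ≤ c → c ≤ r → r ≤ n → f r c ≡ g r c) → build n f ≡ build n g
build-cong zero f g eq = refl
build-cong (suc n) f g eq = cong₂ _,_ (build-cong n f g (λ r c p q s → eq r c p q (≤-trans s (n≤1+n n))))
  (tabulate-cong (λ k → eq (suc n) (suc (toℕ k)) (s≤s z≤n) (s≤s (toℕ≤pred[n] k)) ≤-refl))

build-get : ∀ n (T₀ : Filling n) → build n (get T₀) ≡ T₀
build-get zero tt = refl
build-get (suc n) (T₀ , v) = cong₂ _,_
  (trans (build-cong n _ _ (λ r c p q s → get-low n T₀ v r c (λ eq → <-irrefl eq (s≤s s)))) (build-get n T₀))
  (trans (tabulate-cong (λ k → trans (get-top n T₀ v (suc (toℕ k))) (rowAt-lookup (suc n) v k))) (tabulate∘lookup v))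

build-of-get : ∀ n (T₀ : Filling n) h → (∀ r c → 1 ≤ c → c ≤ r → r ≤ n → h r c ≡ get T₀ r c) → build n h ≡ T₀
build-of-get n T₀ h eq = trans (build-cong n h (get T₀) eq) (build-get n T₀)

-- Searches over 1..N.  lastBelow Q N is the largest r ∈ [1, N] with Q r (0 if
-- none); it computes the previous α/γ row and the column of the last label in a
-- row.  firstAbove Q r N is the smallest s ∈ (r, N] with Q s (0 if none); it
-- computes the next α/γ row.

lastBelow : (ℕ → Bool) → ℕ → ℕ
lastBelow Q zero = zero
lastBelow Q (suc N) = if Q (suc N) then suc N else lastBelow Q N

lastBelow-skip : ∀ Q N → Q (suc N) ≡ false → lastBelow Q (suc N) ≡ lastBelow Q N
lastBelow-skip Q N eq rewrite eq = refl

lastBelow-hit : ∀ Q N → Q (suc N) ≡ true → lastBelow Q (suc N) ≡ suc N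
lastBelow-hit Q N eq rewrite eq = refl

lastBelow-≤ : ∀ Q N → lastBelow Q N ≤ N
lastBelow-≤ Q zero = z≤n
lastBelow-≤ Q (suc N) with Q (suc N)
... | true = ≤-refl
... | false = ≤-trans (lastBelow-≤ Q N) (n≤1+n N)

lastBelow-pred< : ∀ Q r → 0 < r → lastBelow Q (pred r) < r
lastBelow-pred< Q (suc r) _ = s≤s (lastBelow-≤ Q r)

lastBelow-holds : ∀ Q N → 1 ≤ lastBelow Q N → Q (lastBelow Q N) ≡ true
lastBelow-holds Q zero ()
lastBelow-holds Q (suc N) p with Q (suc N) in eq
... | true = eq
... | false = lastBelow-holds Q N p

lastBelow-max : ∀ Q N r → lastBelow Q N < r → r ≤ N → Q r ≡ false
lastBelow-max Q zero r p q = ⊥-elim (<-irrefl refl (<-≤-trans p q))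
lastBelow-max Q (suc N) r p q with Q (suc N) in eq
... | true = ⊥-elim (<-irrefl refl (<-≤-trans p q))
... | false with r ≟ suc N
...   | yes refl = eq
...   | no r≢ = lastBelow-max Q N r p (≤-pred (≤∧≢⇒< q r≢))

lastBelow-≥ : ∀ Q N r → r ≤ N → Q r ≡ true → r ≤ lastBelow Q N
lastBelow-≥ Q N r r≤N holds with r ≤? lastBelow Q N
... | yes p = p
... | no np = ⊥-elim (true≢false (trans (sym holds) (lastBelow-max Q N r (≰⇒> np) r≤N)))

lastBelow-bounded : ∀ Q N m → (∀ r → m < r → r ≤ N → Q r ≡ false) → lastBelow Q N ≤ m
lastBelow-bounded Q N m none with lastBelow Q N ≤? m
... | yes p = p
... | no np = ⊥-elim (true≢false (trans (sym (lastBelow-holds Q N (≤-trans (s≤s z≤n) (≰⇒> np))))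
                         (none (lastBelow Q N) (≰⇒> np) (lastBelow-≤ Q N))))

lastBelow-char : ∀ Q N m → m ≤ N → Q m ≡ true → (∀ r → m < r → r ≤ N → Q r ≡ false) → lastBelow Q N ≡ m
lastBelow-char Q N m m≤N holds none = ≤-antisym (lastBelow-bounded Q N m none) (lastBelow-≥ Q N m m≤N holds)

lastBelow-none : ∀ Q N → (∀ r → 0 < r → r ≤ N → Q r ≡ false) → lastBelow Q N ≡ 0
lastBelow-none Q N none = n≤0⇒n≡0 (lastBelow-bounded Q N 0 none)

firstAbove : (ℕ → Bool) → ℕ → ℕ → ℕ
firstAbove Q r zero = zero
firstAbove Q r (suc N) = if ((firstAbove Q r N ≡ᵇ 0) ∧ ((r <ᵇ suc N) ∧ Q (suc N))) then suc N else firstAbove Q r N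

IsFirstAbove : (ℕ → Bool) → ℕ → ℕ → ℕ → Set
IsFirstAbove Q r N s = (r < s) × (s ≤ N) × (Q s ≡ true) × (∀ t → r < t → t < s → Q t ≡ false)

firstAbove-spec : ∀ Q r N → ((firstAbove Q r N ≡ 0) × (∀ t → r < t → t ≤ N → Q t ≡ false))
                            ⊎ IsFirstAbove Q r N (firstAbove Q r N)
firstAbove-spec Q r zero = inj₁ (refl , λ t p q → ⊥-elim (<-irrefl refl (<-≤-trans (≤-<-trans z≤n p) q)))
firstAbove-spec Q r (suc N) with firstAbove-spec Q r N
... | inj₁ (eq0 , none) rewrite eq0 with r <? suc N
...   | no r≮ rewrite <ᵇ-≮ r≮ = inj₁ (refl , none′)
  where
  none′ : ∀ t → r < t → t ≤ suc N → Q t ≡ false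
  none′ t p q with t ≟ suc N
  ... | yes refl = ⊥-elim (r≮ p)
  ... | no t≢ = none t p (≤-pred (≤∧≢⇒< q t≢))
...   | yes r< rewrite <ᵇ-< r< with Q (suc N) in eqQ
...     | true = inj₂ (r< , ≤-refl , eqQ , λ t a b → none t a (≤-pred b))
...     | false = inj₁ (refl , none′)
  where
  none′ : ∀ t → r < t → t ≤ suc N → Q t ≡ false
  none′ t a q with t ≟ suc N
  ... | yes refl = eqQ
  ... | no t≢ = none t a (≤-pred (≤∧≢⇒< q t≢))
firstAbove-spec Q r (suc N) | inj₂ (a , b , c , d)
  rewrite ≡ᵇ-≢ (firstAbove Q r N) 0 (λ eq → <-irrefl refl (<-≤-trans (≤-<-trans z≤n a) (≤-reflexive eq)))
  = inj₂ (a , ≤-trans b (n≤1+n N) , c , d)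

firstAbove-char : ∀ Q r N s → r < s → s ≤ N → Q s ≡ true → (∀ t → r < t → t < s → Q t ≡ false) → firstAbove Q r N ≡ s
firstAbove-char Q r N s p q holds none with firstAbove-spec Q r N
... | inj₁ (_ , none′) = ⊥-elim (true≢false (trans (sym holds) (none′ s p q)))
... | inj₂ (a , b , c , d) with <-cmp (firstAbove Q r N) s
...   | tri≈ _ x _ = x
...   | tri< x _ _ = ⊥-elim (true≢false (trans (sym c) (none _ a x)))
...   | tri> _ _ x = ⊥-elim (true≢false (trans (sym holds) (d s p x)))

firstAbove-exists : ∀ Q r N s → r < s → s ≤ N → Q s ≡ true → IsFirstAbove Q r N (firstAbove Q r N)
firstAbove-exists Q r N s p q holds with firstAbove-spec Q r N
... | inj₁ (_ , none) = ⊥-elim (true≢false (trans (sym holds) (none s p q)))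
... | inj₂ x = x

beyond-pred : ∀ {c w} → w ≤ c → c ≡ 0 ⊎ w ∸ 1 < c
beyond-pred {zero} {zero} _ = inj₁ refl
beyond-pred {suc c} {zero} _ = inj₂ (s≤s z≤n)
beyond-pred {suc c} {suc w} (s≤s p) = inj₂ (s≤s p)

move-outside : ∀ m a b f r c → (c ≡ 0 ⊎ m < c) → moveUpTo m a b f r c ≡ f r c
move-outside m a b f r zero _ = refl
move-outside m a b f r (suc c) (inj₁ ())
move-outside m a b f r (suc c) (inj₂ p) rewrite <ᵇ-≥ {suc c} {suc m} p = refl

move-target : ∀ m a b f c → 1 ≤ c → c ≤ m → moveUpTo m a b f b c ≡ f a c
move-target m a b f (suc c) _ q rewrite <ᵇ-< {suc c} {suc m} (s≤s q) | ≡ᵇ-refl b = refl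

move-source : ∀ m a b f c → 1 ≤ c → c ≤ m → a ≢ b → moveUpTo m a b f a c ≡ nothing
move-source m a b f (suc c) _ q a≢b rewrite <ᵇ-< {suc c} {suc m} (s≤s q) | ≡ᵇ-≢ a b a≢b | ≡ᵇ-refl a = refl

move-elsewhere : ∀ m a b f r c → r ≢ a → r ≢ b → moveUpTo m a b f r c ≡ f r c
move-elsewhere m a b f r c r≢a r≢b rewrite ≡ᵇ-≢ r a r≢a | ≡ᵇ-≢ r b r≢b with (0 <ᵇ c) ∧ (c <ᵇ suc m)
... | true = refl
... | false = refl

move-cong : ∀ m a b f f′ → (∀ r c → f r c ≡ f′ r c) → ∀ r c → moveUpTo m a b f r c ≡ moveUpTo m a b f′ r c
move-cong m a b f f′ eq r c rewrite eq a c | eq r c = refl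

lastOr0 : List ℕ → ℕ
lastOr0 [] = 0
lastOr0 (x ∷ []) = x
lastOr0 (x ∷ y ∷ l) = lastOr0 (y ∷ l)

lastOr0-snoc : ∀ l z → lastOr0 (l ++ z ∷ []) ≡ z
lastOr0-snoc [] z = refl
lastOr0-snoc (x ∷ []) z = refl
lastOr0-snoc (x ∷ y ∷ l) z = lastOr0-snoc (y ∷ l) z

-- The last move of a chain is the one performed first.
chain-snoc : ∀ l z g r c → chain (l ++ z ∷ []) g r c ≡ chain l (moveL* (lastOr0 l) z g) r c
chain-snoc [] z g r zero = refl
chain-snoc [] z g r (suc c) = refl
chain-snoc (a ∷ []) z g r c = refl
chain-snoc (a ∷ b ∷ l) z g r c =
  move-cong (a ∸ 1) a b _ _ (λ r′ c′ → chain-snoc (b ∷ l) z g r′ c′) r c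

addRow-top : ∀ n z f → addRow n z f (suc n) (suc n) ≡ just z
addRow-top n z f rewrite ≡ᵇ-refl n = refl

addRow-topOff : ∀ n z f c → c ≢ suc n → addRow n z f (suc n) c ≡ nothing
addRow-topOff n z f c c≢ rewrite ≡ᵇ-refl n | ≡ᵇ-≢ c (suc n) c≢ = refl

addRow-low : ∀ n z f r c → r ≢ suc n → addRow n z f r c ≡ f r c
addRow-low n z f r c r≢ rewrite ≡ᵇ-≢ r (suc n) r≢ = refl

setDiag-hit : ∀ i y h → setDiag i y h i i ≡ just y
setDiag-hit i y h rewrite ≡ᵇ-refl i = refl

setDiag-otherRow : ∀ i y h r c → r ≢ i → setDiag i y h r c ≡ h r c
setDiag-otherRow i y h r c r≢ rewrite ≡ᵇ-≢ r i r≢ = refl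

setDiag-otherCol : ∀ i y h r c → c ≢ i → setDiag i y h r c ≡ h r c
setDiag-otherCol i y h r c c≢ rewrite ≡ᵇ-≢ c i c≢ with r ≡ᵇ i
... | true = refl
... | false = refl

-- Q selects rows and L N lists the selected
-- rows of [1, N] in increasing order (specified by its snoc recursion); prev r
-- is the selected row preceding r (0 if there is none).
module ChainEffect (Q : ℕ → Bool) (L : ℕ → List ℕ) (L0 : L 0 ≡ [])
                   (L-suc : ∀ N → L (suc N) ≡ L N ++ (if Q (suc N) then suc N ∷ [] else [])) where

  prev : ℕ → ℕ
  prev r = lastBelow Q (pred r)

  L-skip : ∀ N → Q (suc N) ≡ false → L (suc N) ≡ L N
  L-skip N skip = trans (L-suc N) (trans (cong (λ b → L N ++ (if b then suc N ∷ [] else [])) skip) (++-identityʳ (L N)))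

  L-hit : ∀ N → Q (suc N) ≡ true → L (suc N) ≡ L N ++ suc N ∷ []
  L-hit N hit = trans (L-suc N) (cong (λ b → L N ++ (if b then suc N ∷ [] else [])) hit)

  last-L : ∀ N → lastOr0 (L N) ≡ lastBelow Q N
  last-L zero = cong lastOr0 L0
  last-L (suc N) with Q (suc N) in eqQ
  ... | false = trans (cong lastOr0 (L-skip N eqQ)) (last-L N)
  ... | true = trans (cong lastOr0 (L-hit N eqQ)) (lastOr0-snoc (L N) (suc N))

  L-nil : ∀ N → (∀ t → 0 < t → t ≤ N → Q t ≡ false) → L N ≡ []
  L-nil zero none = L0
  L-nil (suc N) none = trans (L-skip N (none (suc N) (s≤s z≤n) ≤-refl)) (L-nil N (λ t p q → none t p (≤-trans q (n≤1+n N))))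

  L-head : ∀ r → Q r ≡ true → 0 < r → (∀ t → 0 < t → t < r → Q t ≡ false) →
           ∀ N → r ≤ N → Σ (List ℕ) λ rest → L N ≡ r ∷ rest
  L-head r sel 0<r least zero r≤N = ⊥-elim (<-irrefl refl (<-≤-trans 0<r r≤N))
  L-head r sel 0<r least (suc N) r≤N with r ≟ suc N
  ... | yes refl = [] , trans (L-hit N sel) (cong (_++ suc N ∷ []) (L-nil N (λ t a b → least t a (s≤s b))))
  ... | no r≢ with L-head r sel 0<r least N (≤-pred (≤∧≢⇒< r≤N r≢))
  ...   | rest , eq = rest ++ _ , trans (L-suc N) (cong (_++ (if Q (suc N) then suc N ∷ [] else [])) eq)

  Untouched : ℕ → ℕ → ℕ → Set
  Untouched N r c = Q r ≡ false ⊎ N < r ⊎ r ≤ c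

  untouched-lower : ∀ {N r c} → Untouched (suc N) r c → Untouched N r c
  untouched-lower (inj₁ x) = inj₁ x
  untouched-lower {N} (inj₂ (inj₁ x)) = inj₂ (inj₁ (<-trans (n<1+n N) x))
  untouched-lower (inj₂ (inj₂ x)) = inj₂ (inj₂ x)

  record ChainSpec (N : ℕ) (g : CellFun) : Set where
    field
      untouched : ∀ r c → 1 ≤ c → Untouched N r c → chain (L N) g r c ≡ g r c
      copied    : ∀ r c → 1 ≤ c → Q r ≡ true → r ≤ N → c < r → c < prev r → chain (L N) g r c ≡ g (prev r) c
      cleared   : ∀ r c → 1 ≤ c → Q r ≡ true → r ≤ N → c < r → prev r ≤ c → chain (L N) g r c ≡ nothing

  LastRowClear : ℕ → CellFun → Set
  LastRowClear N g = ∀ c → 1 ≤ c → c < lastBelow Q N → g (lastBelow Q N) c ≡ nothing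

  chain-spec-skip : ∀ N g → Q (suc N) ≡ false → ChainSpec N g → ChainSpec (suc N) g
  chain-spec-skip N g skip ih = record
    { untouched = λ r c 1≤c u → trans (same r c) (untouched r c 1≤c (untouched-lower u))
    ; copied = λ r c 1≤c sel r≤ c<r c<p → trans (same r c) (copied r c 1≤c sel (≤N r sel r≤) c<r c<p)
    ; cleared = λ r c 1≤c sel r≤ c<r p≤c → trans (same r c) (cleared r c 1≤c sel (≤N r sel r≤) c<r p≤c)
    }
    where
    open ChainSpec ih
    same : ∀ r c → chain (L (suc N)) g r c ≡ chain (L N) g r c
    same r c = cong (λ l → chain l g r c) (L-skip N skip)
    ≤N : ∀ r → Q r ≡ true → r ≤ suc N → r ≤ N
    ≤N r sel r≤ with r ≟ suc N
    ... | yes refl = ⊥-elim (true≢false (trans (sym sel) skip))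
    ... | no r≢ = ≤-pred (≤∧≢⇒< r≤ r≢)

  -- Row N+1 selected: the chain first performs L*_w → L_{N+1} for the previous
  -- selected row w, then the chain on [1, N] (ChainSpec of the moved array g′).
  module Hit (N : ℕ) (g : CellFun) (hit : Q (suc N) ≡ true) where
    w = lastBelow Q N
    g′ = moveL* w (suc N) g

    w≤N : w ≤ N
    w≤N = lastBelow-≤ Q N

    w≢top : w ≢ suc N
    w≢top eq = <-irrefl eq (s≤s w≤N)

    g′-clear : LastRowClear N g′
    g′-clear c 1≤c c<w = move-source (w ∸ 1) w (suc N) g c 1≤c (<⇒≤pred c<w) w≢top

    unfold : ∀ r c → chain (L (suc N)) g r c ≡ chain (L N) g′ r c
    unfold r c = begin
      chain (L (suc N)) g r c                 ≡⟨ cong (λ l → chain l g r c) (L-hit N hit) ⟩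
      chain (L N ++ suc N ∷ []) g r c         ≡⟨ chain-snoc (L N) (suc N) g r c ⟩
      chain (L N) (moveL* (lastOr0 (L N)) (suc N) g) r c
                                              ≡⟨ cong (λ v → chain (L N) (moveL* v (suc N) g) r c) (last-L N) ⟩
      chain (L N) g′ r c                      ∎
      where open ≡-Reasoning

    chain-spec-hit : LastRowClear (suc N) g → ChainSpec N g′ → ChainSpec (suc N) g
    chain-spec-hit clear ih = record { untouched = untouched′ ; copied = copied′ ; cleared = cleared′ }
      where
      open ChainSpec ih
      top-clear : ∀ c → 1 ≤ c → c < suc N → g (suc N) c ≡ nothing
      top-clear c 1≤c c< = subst (λ v → g v c ≡ nothing) (lastBelow-hit Q N hit)
                             (clear c 1≤c (subst (c <_) (sym (lastBelow-hit Q N hit)) c<))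
      top : ∀ c → 1 ≤ c → chain (L N) g′ (suc N) c ≡ g′ (suc N) c
      top c 1≤c = untouched (suc N) c 1≤c (inj₂ (inj₁ (n<1+n N)))

      w≤c : ∀ {c} → Untouched N w c → w ≤ c
      w≤c {c} u with w ≟ 0
      ... | yes w≡0 = subst (_≤ c) (sym w≡0) z≤n
      ... | no w≢0 with u
      ...   | inj₁ x = ⊥-elim (true≢false (trans (sym (lastBelow-holds Q N (n≢0⇒n>0 w≢0))) x))
      ...   | inj₂ (inj₁ x) = ⊥-elim (<-irrefl refl (≤-trans x w≤N))
      ...   | inj₂ (inj₂ x) = x

      untouched′ : ∀ r c → 1 ≤ c → Untouched (suc N) r c → chain (L (suc N)) g r c ≡ g r c
      untouched′ r c 1≤c u with r ≟ suc N | u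
      ... | yes refl | inj₁ x = ⊥-elim (true≢false (trans (sym hit) x))
      ... | yes refl | inj₂ (inj₁ x) = ⊥-elim (<-irrefl refl x)
      ... | yes refl | inj₂ (inj₂ x) = trans (unfold r c) (trans (top c 1≤c)
              (move-outside (w ∸ 1) w (suc N) g (suc N) c (beyond-pred (≤-trans w≤N (≤-trans (n≤1+n N) x)))))
      ... | no r≢ | _ = trans (unfold r c) (trans (untouched r c 1≤c u′) (g′≡g r≢))
        where
        u′ : Untouched N r c
        u′ = untouched-lower u
        g′≡g : r ≢ suc N → g′ r c ≡ g r c
        g′≡g r≢ with r ≟ w
        ... | no r≢w = move-elsewhere (w ∸ 1) w (suc N) g r c r≢w r≢
        ... | yes refl = move-outside (w ∸ 1) w (suc N) g w c (beyond-pred (w≤c u′))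

      copied′ : ∀ r c → 1 ≤ c → Q r ≡ true → r ≤ suc N → c < r → c < prev r → chain (L (suc N)) g r c ≡ g (prev r) c
      copied′ r c 1≤c sel r≤ c<r c<p with r ≟ suc N
      ... | yes refl = trans (unfold r c) (trans (top c 1≤c) (move-target (w ∸ 1) w (suc N) g c 1≤c (<⇒≤pred c<p)))
      ... | no r≢ = trans (unfold r c) (trans (copied r c 1≤c sel r≤N c<r c<p)
                      (move-elsewhere (w ∸ 1) w (suc N) g (prev r) c (<⇒≢ (<-≤-trans p<r (lastBelow-≥ Q N r r≤N sel)))
                        (<⇒≢ (<-≤-trans p<r r≤))))
        where
        r≤N : r ≤ N
        r≤N = ≤-pred (≤∧≢⇒< r≤ r≢)
        p<r : prev r < r
        p<r = lastBelow-pred< Q r (≤-<-trans z≤n c<r)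

      cleared′ : ∀ r c → 1 ≤ c → Q r ≡ true → r ≤ suc N → c < r → prev r ≤ c → chain (L (suc N)) g r c ≡ nothing
      cleared′ r c 1≤c sel r≤ c<r p≤c with r ≟ suc N
      ... | yes refl = trans (unfold r c) (trans (top c 1≤c)
                         (trans (move-outside (w ∸ 1) w (suc N) g (suc N) c (beyond-pred p≤c)) (top-clear c 1≤c c<r)))
      ... | no r≢ = trans (unfold r c) (cleared r c 1≤c sel (≤-pred (≤∧≢⇒< r≤ r≢)) c<r p≤c)

  chain-spec : ∀ N g → LastRowClear N g → ChainSpec N g
  chain-spec zero g _ = record
    { untouched = λ r c _ _ → cong (λ l → chain l g r c) L0
    ; copied = λ r c 1≤c _ r≤0 c<r _ → ⊥-elim (<-irrefl refl (<-≤-trans (<-trans 1≤c c<r) r≤0))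
    ; cleared = λ r c 1≤c _ r≤0 c<r _ → ⊥-elim (<-irrefl refl (<-≤-trans (<-trans 1≤c c<r) r≤0))
    }
  chain-spec (suc N) g clear = step (Q (suc N)) refl
    where
    step : ∀ b → Q (suc N) ≡ b → ChainSpec (suc N) g
    step false skip = chain-spec-skip N g skip (chain-spec N g clear′)
      where
      clear′ : LastRowClear N g
      clear′ c 1≤c c< = subst (λ v → g v c ≡ nothing) (lastBelow-skip Q N skip)
                          (clear c 1≤c (subst (c <_) (sym (lastBelow-skip Q N skip)) c<))
    step true hit = Hit.chain-spec-hit N g hit clear (chain-spec N (Hit.g′ N g hit) (Hit.g′-clear N g hit))

filter-singleton : ∀ {P : ℕ → Set} (P? : (x : ℕ) → Dec (P x)) x → filter P? (x ∷ []) ≡ (if does (P? x) then x ∷ [] else [])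
filter-singleton P? x with does (P? x)
... | true = refl
... | false = refl

map-suc-upTo-suc : ∀ N → map suc (upTo (suc N)) ≡ map suc (upTo N) ++ suc N ∷ []
map-suc-upTo-suc N = trans (cong (map suc) (sym (upTo-∷ʳ N))) (map-++ suc (upTo N) (N ∷ []))

agRows-suc : ∀ N g → agRows (suc N) g ≡ agRows N g ++ (if isAGCell (g (suc N) (suc N)) then suc N ∷ [] else [])
agRows-suc N g = begin
  agRows (suc N) g                                     ≡⟨ cong (filter P?) (map-suc-upTo-suc N) ⟩
  filter P? (map suc (upTo N) ++ suc N ∷ [])           ≡⟨ filter-++ P? (map suc (upTo N)) (suc N ∷ []) ⟩
  agRows N g ++ filter P? (suc N ∷ [])                 ≡⟨ cong (agRows N g ++_) (filter-singleton P? (suc N)) ⟩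
  agRows N g ++ (if does (P? (suc N)) then suc N ∷ [] else [])
                                                       ≡⟨ cong (λ b → agRows N g ++ (if b then suc N ∷ [] else [])) (does-≟true _) ⟩
  agRows N g ++ (if isAGCell (g (suc N) (suc N)) then suc N ∷ [] else []) ∎
  where
  open ≡-Reasoning
  P? = λ r → isAGCell (g r r) ≟-Bool true
  does-≟true : ∀ b → does (b ≟-Bool true) ≡ b
  does-≟true true = refl
  does-≟true false = refl

-- The same, with the condition written as agAbove … 0 (N+1) below.
agRows-suc′ : ∀ N g → agRows (suc N) g ≡ agRows N g ++ (if isAGCell (g (suc N) (suc N)) ∧ (0 <ᵇ suc N) then suc N ∷ [] else [])
agRows-suc′ N g = trans (agRows-suc N g) (cong (λ b → agRows N g ++ (if b then suc N ∷ [] else [])) (sym (∧-identityʳ _)))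

agRowsAbove-suc : ∀ i N g → agRowsAbove i (suc N) g ≡ agRowsAbove i N g ++ (if isAGCell (g (suc N) (suc N)) ∧ (i <ᵇ suc N) then suc N ∷ [] else [])
agRowsAbove-suc i N g = trans (cong (filter (i <?_)) (agRows-suc N g))
   (trans (filter-++ (i <?_) (agRows N g) _) (cong (agRowsAbove i N g ++_) (filter-if (isAGCell (g (suc N) (suc N))))))
  where
  filter-if : ∀ b → filter (i <?_) (if b then suc N ∷ [] else []) ≡ (if b ∧ (i <ᵇ suc N) then suc N ∷ [] else [])
  filter-if false = refl
  filter-if true = filter-singleton (i <?_) (suc N)

-- Fix the array f of size n, the α/γ label z of
-- the new top row and the inserted row i (i = 0 for the letters α, γ); let
-- g = addRow n z f.  agAbove r: row r of g is of type α/γ and lies above row i.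
-- prevAG r: the previous such row below r (0 if r is the first one).

agAbove : ℕ → Sym → CellFun → ℕ → ℕ → Bool
agAbove n z f i r = isAGCell (addRow n z f r r) ∧ (i <ᵇ r)

prevAG : ℕ → Sym → CellFun → ℕ → ℕ → ℕ
prevAG n z f i r = lastBelow (agAbove n z f i) (pred r)

record InsertionShape (n : ℕ) (f : CellFun) (z : Sym) (i : ℕ) (y : Sym) (R : CellFun) : Set where
  field
    below        : ∀ r c → 1 ≤ c → c ≤ r → r < i → R r c ≡ f r c
    diag         : 1 ≤ i → R i i ≡ just y
    leftOfDiag   : ∀ c → 1 ≤ c → c < i → R i c ≡ nothing
    nonAGRow     : ∀ r c → 1 ≤ c → c ≤ r → i < r → r ≤ suc n → agAbove n z f i r ≡ false → R r c ≡ f r c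
    agDiag       : ∀ r → 1 ≤ r → r ≤ suc n → agAbove n z f i r ≡ true → R r r ≡ addRow n z f r r
    shifted      : ∀ r c → 1 ≤ c → c < r → r ≤ suc n → agAbove n z f i r ≡ true →
                   1 ≤ prevAG n z f i r → c < prevAG n z f i r → R r c ≡ f (prevAG n z f i r) c
    shiftedEmpty : ∀ r c → 1 ≤ c → c < r → r ≤ suc n → agAbove n z f i r ≡ true →
                   1 ≤ prevAG n z f i r → prevAG n z f i r ≤ c → R r c ≡ nothing
    firstShifted : ∀ r c → 1 ≤ c → c < r → r ≤ suc n → agAbove n z f i r ≡ true →
                   prevAG n z f i r ≡ 0 → c ≤ i → R r c ≡ f i c
    firstEmpty   : ∀ r c → 1 ≤ c → c < r → r ≤ suc n → agAbove n z f i r ≡ true →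
                   prevAG n z f i r ≡ 0 → i < c → R r c ≡ nothing

InsertionShape-ext : ∀ {n f z i y R R′} → (∀ r c → R r c ≡ R′ r c) → InsertionShape n f z i y R → InsertionShape n f z i y R′
InsertionShape-ext {i = i} eq S = record
  { below = λ r c a b x → trans (sym (eq r c)) (below r c a b x)
  ; diag = λ a → trans (sym (eq i i)) (diag a)
  ; leftOfDiag = λ c a x → trans (sym (eq i c)) (leftOfDiag c a x)
  ; nonAGRow = λ r c a b x y w → trans (sym (eq r c)) (nonAGRow r c a b x y w)
  ; agDiag = λ r a x y → trans (sym (eq r r)) (agDiag r a x y)
  ; shifted = λ r c a b x y w v → trans (sym (eq r c)) (shifted r c a b x y w v)
  ; shiftedEmpty = λ r c a b x y w v → trans (sym (eq r c)) (shiftedEmpty r c a b x y w v)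
  ; firstShifted = λ r c a b x y w v → trans (sym (eq r c)) (firstShifted r c a b x y w v)
  ; firstEmpty = λ r c a b x y w v → trans (sym (eq r c)) (firstEmpty r c a b x y w v)
  }
  where open InsertionShape S

agAbove-< : ∀ n z f i r → agAbove n z f i r ≡ true → i < r
agAbove-< n z f i r sel with i <ᵇ r in eq
... | true = <ᵇ⇒<′ i r eq
... | false = ⊥-elim (true≢false (trans (sym sel) (∧-zeroʳ _)))

agAbove-below : ∀ n z f i r → r ≤ i → agAbove n z f i r ≡ false
agAbove-below n z f i r r≤i rewrite <ᵇ-≥ {i} {r} r≤i = ∧-zeroʳ _

agAbove-top : ∀ n z f i → isAG z ≡ true → i < suc n → agAbove n z f i (suc n) ≡ true
agAbove-top n z f i z-AG i< rewrite addRow-top n z f | <ᵇ-< i< = trans (∧-identityʳ _) z-AG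

isAG-agSym : ∀ x → isAG (agSym x) ≡ true
isAG-agSym αₓ = refl
isAG-agSym γₓ = refl

isAG-bdSym : ∀ y → isAG (bdSym y) ≡ false
isAG-bdSym βᵧ = refl
isAG-bdSym δᵧ = refl

-- The first α/γ row r0 above i (it exists: the new top row is one).  It is the
-- only α/γ row above i without a previous one.
module FirstAGAbove (n : ℕ) (z : Sym) (f : CellFun) (i : ℕ) (z-AG : isAG z ≡ true) (i≤n : i ≤ n) where
  private
    Q = agAbove n z f i

  r0 = firstAbove Q 0 (suc n)

  r0-first : IsFirstAbove Q 0 (suc n) r0
  r0-first = firstAbove-exists Q 0 (suc n) (suc n) (s≤s z≤n) ≤-refl (agAbove-top n z f i z-AG (s≤s i≤n))

  r0-selected : Q r0 ≡ true
  r0-selected = proj₁ (proj₂ (proj₂ r0-first))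

  r0≤ : r0 ≤ suc n
  r0≤ = proj₁ (proj₂ r0-first)

  none-below-r0 : ∀ t → 0 < t → t < r0 → Q t ≡ false
  none-below-r0 = proj₂ (proj₂ (proj₂ r0-first))

  i<r0 : i < r0
  i<r0 = agAbove-< n z f i r0 r0-selected

  prev-r0 : prevAG n z f i r0 ≡ 0
  prev-r0 = lastBelow-none Q (pred r0) (λ t p q → none-below-r0 t p (≤pred⇒< q (proj₁ r0-first)))

  r0-unique : ∀ r → Q r ≡ true → r ≤ suc n → prevAG n z f i r ≡ 0 → r ≡ r0
  r0-unique r sel r≤ p0 with <-cmp r r0
  ... | tri≈ _ x _ = x
  ... | tri< x _ _ = ⊥-elim (true≢false (trans (sym sel) (none-below-r0 r (≤-<-trans z≤n (agAbove-< n z f i r sel)) x)))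
  ... | tri> _ _ x = ⊥-elim (<-irrefl refl (<-≤-trans (proj₁ r0-first) (subst (r0 ≤_) p0 (lastBelow-≥ Q (pred r) r0 (<⇒≤pred x) r0-selected))))

-- Its effect is the ChainSpec of ChainEffect; since
-- the top row is selected and empty off the diagonal, the hypothesis holds.
module InsertionChain (n : ℕ) (z : Sym) (f : CellFun) (i : ℕ) (z-AG : isAG z ≡ true) (i≤n : i ≤ n)
                      (L : ℕ → List ℕ) (L0 : L 0 ≡ [])
                      (L-suc : ∀ N → L (suc N) ≡ L N ++ (if agAbove n z f i (suc N) then suc N ∷ [] else [])) where
  g = addRow n z f
  Q = agAbove n z f i
  C = chain (L (suc n)) g
  open ChainEffect Q L L0 L-suc public

  top-selected : Q (suc n) ≡ true
  top-selected = agAbove-top n z f i z-AG (s≤s i≤n)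

  C-spec : ChainSpec (suc n) g
  C-spec = chain-spec (suc n) g (λ c 1≤c c< → subst (λ v → g v c ≡ nothing) (sym (lastBelow-hit Q n top-selected))
             (addRow-topOff n z f c (<⇒≢ (subst (c <_) (lastBelow-hit Q n top-selected) c<))))

  C-nonAG : ∀ r c → 1 ≤ c → Q r ≡ false → C r c ≡ f r c
  C-nonAG r c 1≤c skip = trans (ChainSpec.untouched C-spec r c 1≤c (inj₁ skip)) (addRow-low n z f r c r≢top)
    where
    r≢top : r ≢ suc n
    r≢top refl = true≢false (trans (sym top-selected) skip)

  C-diag : ∀ r → 1 ≤ r → C r r ≡ g r r
  C-diag r 1≤r = ChainSpec.untouched C-spec r r 1≤r (inj₂ (inj₂ ≤-refl))

  C-shifted : ∀ r c → 1 ≤ c → c < r → r ≤ suc n → Q r ≡ true → c < prev r → C r c ≡ f (prev r) c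
  C-shifted r c 1≤c c<r r≤ sel c<p = trans (ChainSpec.copied C-spec r c 1≤c sel r≤ c<r c<p)
    (addRow-low n z f _ c (<⇒≢ (<-≤-trans (lastBelow-pred< Q r (<-trans 1≤c c<r)) r≤)))

  C-cleared : ∀ r c → 1 ≤ c → c < r → r ≤ suc n → Q r ≡ true → prev r ≤ c → C r c ≡ nothing
  C-cleared r c 1≤c c<r r≤ sel p≤c = ChainSpec.cleared C-spec r c 1≤c sel r≤ c<r p≤c

-- Inserting a letter α or γ is the chain alone (i = 0).
module LetterShape (n : ℕ) (f : CellFun) (z : Sym) (z-AG : isAG z ≡ true) where
  open InsertionChain n z f 0 z-AG z≤n (λ N → agRows N (addRow n z f)) refl (λ N → agRows-suc′ N (addRow n z f))

  R = C

  shape : InsertionShape n f z 0 β R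
  shape = record
    { below = λ r c _ _ ()
    ; diag = λ ()
    ; leftOfDiag = λ _ _ ()
    ; nonAGRow = λ r c 1≤c _ _ _ skip → C-nonAG r c 1≤c skip
    ; agDiag = λ r 1≤r _ _ → C-diag r 1≤r
    ; shifted = λ r c 1≤c c<r r≤ sel _ c<p → C-shifted r c 1≤c c<r r≤ sel c<p
    ; shiftedEmpty = λ r c 1≤c c<r r≤ sel _ p≤c → C-cleared r c 1≤c c<r r≤ sel p≤c
    ; firstShifted = λ r c 1≤c _ _ _ _ c≤0 → ⊥-elim (<-irrefl refl (≤-trans 1≤c c≤0))
    ; firstEmpty = λ r c 1≤c c<r r≤ sel p0 _ → C-cleared r c 1≤c c<r r≤ sel (subst (_≤ c) (sym p0) z≤n)
    }

module TripleShape (n : ℕ) (f : CellFun) (x : AG) (y : BD) (k : Fin n) where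
  i = suc (toℕ k)

  i≤n : i ≤ n
  i≤n = toℕ<n k

  open InsertionChain n (agSym x) f i (isAG-agSym x) i≤n (λ N → agRowsAbove i N (addRow n (agSym x) f)) refl
         (λ N → agRowsAbove-suc i N (addRow n (agSym x) f))
  open FirstAGAbove n (agSym x) f i (isAG-agSym x) i≤n

  il = headOr (suc n) (agRowsAbove i (suc n) g)

  il≡r0 : il ≡ r0
  il≡r0 with L-head r0 r0-selected (≤-<-trans z≤n i<r0) none-below-r0 (suc n) r0≤
  ... | rest , eq = cong (headOr (suc n)) eq

  R = insertionFun n f (triple x y k)

  R-rowI : ∀ c → c ≢ i → R i c ≡ moveL i il C i c
  R-rowI c c≢i = setDiag-otherCol i (bdSym y) (moveL i il C) i c c≢i

  R-rest : ∀ r c → r ≢ i → (r ≢ r0 ⊎ i < c) → R r c ≡ C r c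
  R-rest r c r≢i (inj₁ r≢r0) = trans (setDiag-otherRow i (bdSym y) (moveL i il C) r c r≢i)
    (move-elsewhere i i il C r c r≢i (λ eq → r≢r0 (trans eq il≡r0)))
  R-rest r c r≢i (inj₂ i<c) = trans (setDiag-otherRow i (bdSym y) (moveL i il C) r c r≢i)
    (move-outside i i il C r c (inj₂ i<c))

  C-rowI : ∀ c → 1 ≤ c → C i c ≡ f i c
  C-rowI c 1≤c = trans (ChainSpec.untouched C-spec i c 1≤c (inj₁ (agAbove-below n (agSym x) f i i ≤-refl)))
                   (addRow-low n (agSym x) f i c (<⇒≢ (s≤s i≤n)))

  above≢i : ∀ r → i < r → r ≢ i
  above≢i r i<r = ≢-sym (<⇒≢ i<r)

  shape : InsertionShape n f (agSym x) i (bdSym y) R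
  shape = record
    { below = λ r c 1≤c _ r<i → trans (R-rest r c (<⇒≢ r<i) (inj₁ (<⇒≢ (<-trans r<i i<r0))))
                 (trans (ChainSpec.untouched C-spec r c 1≤c (inj₁ (agAbove-below n (agSym x) f i r (<⇒≤ r<i))))
                   (addRow-low n (agSym x) f r c (<⇒≢ (<-≤-trans r<i (≤-trans i≤n (n≤1+n n))))))
    ; diag = λ _ → setDiag-hit i (bdSym y) (moveL i il C)
    ; leftOfDiag = λ c 1≤c c<i → trans (R-rowI c (<⇒≢ c<i)) (move-source i i il C c 1≤c (<⇒≤ c<i) (λ eq → <⇒≢ i<r0 (trans eq il≡r0)))
    ; nonAGRow = λ r c 1≤c _ i<r _ skip → trans (R-rest r c (above≢i r i<r) (inj₁ (λ { refl → true≢false (trans (sym r0-selected) skip) })))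
                   (C-nonAG r c 1≤c skip)
    ; agDiag = λ r 1≤r _ sel → trans (R-rest r r (above≢i r (above-i r sel)) (inj₂ (above-i r sel))) (C-diag r 1≤r)
    ; shifted = λ r c 1≤c c<r r≤ sel p≥1 c<p → trans (R-rest r c (above≢i r (above-i r sel)) (inj₁ (≢r0 r p≥1)))
                  (C-shifted r c 1≤c c<r r≤ sel c<p)
    ; shiftedEmpty = λ r c 1≤c c<r r≤ sel p≥1 p≤c → trans (R-rest r c (above≢i r (above-i r sel)) (inj₁ (≢r0 r p≥1)))
                  (C-cleared r c 1≤c c<r r≤ sel p≤c)
    ; firstShifted = λ r c 1≤c c<r r≤ sel p0 c≤i →
                  trans (setDiag-otherRow i (bdSym y) (moveL i il C) r c (above≢i r (above-i r sel)))
                  (trans (cong (λ r′ → moveUpTo i i il C r′ c) (trans (r0-unique r sel r≤ p0) (sym il≡r0)))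
                  (trans (move-target i i il C c 1≤c c≤i) (C-rowI c 1≤c)))
    ; firstEmpty = λ r c 1≤c c<r r≤ sel p0 i<c → trans (R-rest r c (above≢i r (above-i r sel)) (inj₂ i<c))
                  (C-cleared r c 1≤c c<r r≤ sel (subst (_≤ c) (sym p0) z≤n))
    }
    where
    above-i : ∀ r → Q r ≡ true → i < r
    above-i = agAbove-< n (agSym x) f i
    ≢r0 : ∀ r → 1 ≤ prevAG n (agSym x) f i r → r ≢ r0
    ≢r0 r p≥1 refl = <-irrefl refl (≤-trans p≥1 (≤-reflexive prev-r0))

record Staircase (N : ℕ) (h : CellFun) : Set where
  field
    diagFull : ∀ i → 1 ≤ i → i ≤ N → h i i ≡ nothing → ⊥
    aboveAG  : ∀ i j → 1 ≤ j → j ≤ i → i ≤ N → IsAGLabel (h i j) →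
               ∀ i′ → i < i′ → i′ ≤ N → h i′ j ≡ nothing
    leftOfBD : ∀ i j → 1 ≤ j → j ≤ i → i ≤ N → IsBDLabel (h i j) →
               ∀ j′ → 1 ≤ j′ → j′ < j → h i j′ ≡ nothing

staircase-get : ∀ N T → IsStaircase N T → Staircase N (get T)
staircase-get N T s = record { diagFull = IsStaircase.diagLabelled s ; aboveAG = IsStaircase.agColumn s ; leftOfBD = IsStaircase.bdRow s }

staircase-build : ∀ N h → Staircase N h → IsStaircase N (build N h)
staircase-build N h s = record
  { diagLabelled = λ i p q e → Staircase.diagFull s i p q (trans (sym (gb i i p ≤-refl q)) e)
  ; agColumn = λ i j p q r a i′ t u → trans (gb i′ j p (≤-trans q (<⇒≤ t)) u)
        (Staircase.aboveAG s i j p q r (subst IsAGLabel (gb i j p q r) a) i′ t u)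
  ; bdRow = λ i j p q r b j′ p′ t → trans (gb i j′ p′ (≤-trans (<⇒≤ t) q) r)
        (Staircase.leftOfBD s i j p q r (subst IsBDLabel (gb i j p q r) b) j′ p′ t)
  }
  where
  gb = get-build N h

staircase-restrict : ∀ n h → Staircase (suc n) h → Staircase n h
staircase-restrict n h s = record
  { diagFull = λ r a rn → Staircase.diagFull s r a (≤-trans rn (n≤1+n n))
  ; aboveAG = λ r c a b rn al r′ t rn′ → Staircase.aboveAG s r c a b (≤-trans rn (n≤1+n n)) al r′ t (≤-trans rn′ (n≤1+n n))
  ; leftOfBD = λ r c a b rn → Staircase.leftOfBD s r c a b (≤-trans rn (n≤1+n n)) }

agLabel-isAG : ∀ {c} → IsAGLabel c → isAGCell c ≡ true
agLabel-isAG isα = refl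
agLabel-isAG isγ = refl

isAG-agLabel : ∀ c → isAGCell c ≡ true → IsAGLabel c
isAG-agLabel (just α) _ = isα
isAG-agLabel (just γ) _ = isγ
isAG-agLabel (just β) ()
isAG-agLabel (just δ) ()
isAG-agLabel nothing ()

bdLabel-notAG : ∀ {c} → IsBDLabel c → isAGCell c ≡ false
bdLabel-notAG isβ = refl
bdLabel-notAG isδ = refl

notAG-bdLabel : ∀ c → (c ≡ nothing → ⊥) → isAGCell c ≡ false → IsBDLabel c
notAG-bdLabel (just β) _ _ = isβ
notAG-bdLabel (just δ) _ _ = isδ
notAG-bdLabel (just α) _ ()
notAG-bdLabel (just γ) _ ()
notAG-bdLabel nothing nonempty _ = ⊥-elim (nonempty refl)

agLabel-nonempty : ∀ {c} → IsAGLabel c → c ≡ nothing → ⊥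
agLabel-nonempty isα ()
agLabel-nonempty isγ ()

bdLabel-nonempty : ∀ {c} → IsBDLabel c → c ≡ nothing → ⊥
bdLabel-nonempty isβ ()
bdLabel-nonempty isδ ()

bdRowEmpty : ∀ {N h} → Staircase N h → ∀ r c → 1 ≤ c → c < r → r ≤ N → isAGCell (h r r) ≡ false → h r c ≡ nothing
bdRowEmpty {N} {h} s r c 1≤c c<r r≤N notAG =
  Staircase.leftOfBD s r r 1≤r ≤-refl r≤N (notAG-bdLabel (h r r) (Staircase.diagFull s r 1≤r r≤N) notAG) c 1≤c c<r
  where 1≤r = ≤-trans 1≤c (<⇒≤ c<r)

just≢nothing : ∀ {s : Sym} → just s ≢ nothing
just≢nothing ()

staircase-addRow : ∀ n f z → Staircase n f → Staircase (suc n) (addRow n z f)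
staircase-addRow n f z st = record { diagFull = diagFull′ ; aboveAG = aboveAG′ ; leftOfBD = leftOfBD′ }
  where
  diagFull′ : ∀ r → 1 ≤ r → r ≤ suc n → addRow n z f r r ≡ nothing → ⊥
  diagFull′ r a rn e with r ≟ suc n
  ... | yes refl = just≢nothing (trans (sym (addRow-top n z f)) e)
  ... | no r≢ = Staircase.diagFull st r a (≤-pred (≤∧≢⇒< rn r≢)) (trans (sym (addRow-low n z f r r r≢)) e)
  aboveAG′ : ∀ r c → 1 ≤ c → c ≤ r → r ≤ suc n → IsAGLabel (addRow n z f r c) →
             ∀ r′ → r < r′ → r′ ≤ suc n → addRow n z f r′ c ≡ nothing
  aboveAG′ r c a b rn al r′ r<r′ rn′ with r′ ≟ suc n
  ... | yes refl = addRow-topOff n z f c (<⇒≢ (≤-<-trans b r<r′))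
  ... | no r′≢ = trans (addRow-low n z f r′ c r′≢) (Staircase.aboveAG st r c a b (≤-pred (<-≤-trans r<r′ rn′))
                  (subst IsAGLabel (addRow-low n z f r c (<⇒≢ (<-≤-trans r<r′ rn′))) al) r′ r<r′ (≤-pred (≤∧≢⇒< rn′ r′≢)))
  leftOfBD′ : ∀ r c → 1 ≤ c → c ≤ r → r ≤ suc n → IsBDLabel (addRow n z f r c) →
              ∀ c′ → 1 ≤ c′ → c′ < c → addRow n z f r c′ ≡ nothing
  leftOfBD′ r c a b rn bl c′ a′ c′<c with r ≟ suc n
  ... | yes refl = addRow-topOff n z f c′ (<⇒≢ (<-≤-trans c′<c b))
  ... | no r≢ = trans (addRow-low n z f r c′ r≢) (Staircase.leftOfBD st r c a b (≤-pred (≤∧≢⇒< rn r≢))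
                  (subst IsBDLabel (addRow-low n z f r c r≢) bl) c′ a′ c′<c)

module ShapeView (n : ℕ) (f : CellFun) (z : Sym) (i : ℕ) (y : Sym) (R : CellFun)
                 (S : InsertionShape n f z i y R) (z-AG : isAG z ≡ true) (i≤n : i ≤ n) where
  open InsertionShape S public
  Qf = agAbove n z f i
  p = prevAG n z f i
  g = addRow n z f

  data RowView (r c : ℕ) : Set where
    vBelow        : r < i → R r c ≡ f r c → RowView r c
    vDiag         : r ≡ i → c ≡ i → R r c ≡ just y → RowView r c
    vLeftOfDiag   : r ≡ i → c < i → R r c ≡ nothing → RowView r c
    vNonAG        : i < r → Qf r ≡ false → R r c ≡ f r c → RowView r c
    vAGDiag       : i < r → Qf r ≡ true → c ≡ r → R r c ≡ g r r → RowView r c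
    vShifted      : i < r → Qf r ≡ true → c < r → 1 ≤ p r → c < p r → R r c ≡ f (p r) c → RowView r c
    vShiftedEmpty : i < r → Qf r ≡ true → c < r → 1 ≤ p r → p r ≤ c → R r c ≡ nothing → RowView r c
    vFirstEmpty   : i < r → Qf r ≡ true → c < r → p r ≡ 0 → i < c → R r c ≡ nothing → RowView r c
    vFirstShifted : i < r → Qf r ≡ true → c < r → p r ≡ 0 → c ≤ i → R r c ≡ f i c → RowView r c

  view : ∀ r c → 1 ≤ c → c ≤ r → r ≤ suc n → RowView r c
  view r c a b rn with <-cmp r i
  ... | tri< x _ _ = vBelow x (below r c a b x)
  ... | tri≈ _ refl _ with c ≟ r
  ...   | yes refl = vDiag refl refl (diag a)
  ...   | no c≢ = vLeftOfDiag refl (≤∧≢⇒< b c≢) (leftOfDiag c a (≤∧≢⇒< b c≢))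
  view r c a b rn | tri> _ _ x with Qf r in sel
  ... | false = vNonAG x sel (nonAGRow r c a b x rn sel)
  ... | true with c ≟ r
  ...   | yes refl = vAGDiag x sel refl (agDiag r a rn sel)
  ...   | no c≢ with p r ≟ 0
  ...     | yes p0 with c ≤? i
  ...       | yes c≤i = vFirstShifted x sel (≤∧≢⇒< b c≢) p0 c≤i (firstShifted r c a (≤∧≢⇒< b c≢) rn sel p0 c≤i)
  ...       | no c≰i = vFirstEmpty x sel (≤∧≢⇒< b c≢) p0 (≰⇒> c≰i) (firstEmpty r c a (≤∧≢⇒< b c≢) rn sel p0 (≰⇒> c≰i))
  view r c a b rn | tri> _ _ x | true | no c≢ | no p≢0 with c <? p r
  ...       | yes c<p = vShifted x sel (≤∧≢⇒< b c≢) (n≢0⇒n>0 p≢0) c<p (shifted r c a (≤∧≢⇒< b c≢) rn sel (n≢0⇒n>0 p≢0) c<p)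
  ...       | no c≮p = vShiftedEmpty x sel (≤∧≢⇒< b c≢) (n≢0⇒n>0 p≢0) (≮⇒≥ c≮p)
                           (shiftedEmpty r c a (≤∧≢⇒< b c≢) rn sel (n≢0⇒n>0 p≢0) (≮⇒≥ c≮p))

  Qtop : Qf (suc n) ≡ true
  Qtop = agAbove-top n z f i z-AG (s≤s i≤n)

  Q→≤n : ∀ r → r ≤ suc n → Qf r ≡ false → r ≤ n
  Q→≤n r rn skip with r ≟ suc n
  ... | yes refl = ⊥-elim (true≢false (trans (sym Qtop) skip))
  ... | no r≢ = ≤-pred (≤∧≢⇒< rn r≢)

  Qeq : ∀ r → i < r → Qf r ≡ isAGCell (g r r)
  Qeq r i<r rewrite <ᵇ-< i<r = ∧-identityʳ _

  Q≥1 : ∀ r → Qf r ≡ true → 1 ≤ r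
  Q≥1 r sel = ≤-<-trans z≤n (agAbove-< n z f i r sel)

  p-lt : ∀ r → 1 ≤ r → p r < r
  p-lt r 1≤r = lastBelow-pred< Qf r 1≤r

  p-n : ∀ r → 1 ≤ r → r ≤ suc n → p r ≤ n
  p-n r 1≤r rn = ≤-pred (<-≤-trans (p-lt r 1≤r) rn)

  p-Q : ∀ r → 1 ≤ p r → Qf (p r) ≡ true
  p-Q r 1≤p = lastBelow-holds Qf (pred r) 1≤p

  p-i : ∀ r → 1 ≤ p r → i < p r
  p-i r 1≤p = agAbove-< n z f i (p r) (p-Q r 1≤p)

  r≤p : ∀ r r′ → Qf r ≡ true → r < r′ → r ≤ p r′
  r≤p r (suc r′) sel (s≤s r≤r′) = lastBelow-≥ Qf r′ r r≤r′ sel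

  p-nonzero : ∀ r r′ → Qf r ≡ true → r < r′ → p r′ ≡ 0 → ⊥
  p-nonzero r r′ sel r<r′ p0 = <-irrefl refl (≤-trans (Q≥1 r sel) (subst (r ≤_) p0 (r≤p r r′ sel r<r′)))

  g-low : ∀ r c → r ≤ n → g r c ≡ f r c
  g-low r c r≤n = addRow-low n z f r c (<⇒≢ (s≤s r≤n))

module Preservation (n : ℕ) (f : CellFun) (z : Sym) (i : ℕ) (y : Sym) (R : CellFun) (S : InsertionShape n f z i y R)
                    (z-AG : isAG z ≡ true) (y-BD : isAG y ≡ false) (i≤n : i ≤ n) (st : Staircase n f) where
  open ShapeView n f z i y R S z-AG i≤n

  -- Every diagonal cell comes from a diagonal cell of f, from y or from z.
  diag-R : ∀ r → 1 ≤ r → r ≤ suc n → R r r ≡ nothing → ⊥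
  diag-R r a rn with view r r a ≤-refl rn
  ... | vBelow x e = λ e′ → Staircase.diagFull st r a (≤-trans (<⇒≤ x) i≤n) (trans (sym e) e′)
  ... | vDiag _ _ e = λ e′ → just≢nothing (trans (sym e) e′)
  ... | vLeftOfDiag refl x _ = ⊥-elim (<-irrefl refl x)
  ... | vNonAG x q e = λ e′ → Staircase.diagFull st r a (Q→≤n r rn q) (trans (sym e) e′)
  ... | vAGDiag x q _ e with r ≟ suc n
  ...   | yes refl = λ e′ → just≢nothing (trans (sym (trans e (addRow-top n z f))) e′)
  ...   | no r≢ = λ e′ → Staircase.diagFull st r a r≤n (trans (sym (trans e (g-low r r r≤n))) e′)
    where r≤n = ≤-pred (≤∧≢⇒< rn r≢)
  diag-R r a rn | vShifted _ _ x _ _ _ = ⊥-elim (<-irrefl refl x)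
  diag-R r a rn | vShiftedEmpty _ _ x _ _ _ = ⊥-elim (<-irrefl refl x)
  diag-R r a rn | vFirstEmpty _ _ x _ _ _ = ⊥-elim (<-irrefl refl x)
  diag-R r a rn | vFirstShifted _ _ x _ _ _ = ⊥-elim (<-irrefl refl x)

  -- A β/δ cell of R is the image of a β/δ cell of a whole row prefix of f (or
  -- is y), and the cells left of it come from that same row prefix.
  leftOfBD-R : ∀ r c → 1 ≤ c → c ≤ r → r ≤ suc n → IsBDLabel (R r c) → ∀ c′ → 1 ≤ c′ → c′ < c → R r c′ ≡ nothing
  leftOfBD-R r c a b rn bl c′ a′ t with view r c a b rn
  ... | vBelow x e = trans (below r c′ a′ (≤-trans (<⇒≤ t) b) x)
          (Staircase.leftOfBD st r c a b (≤-trans (<⇒≤ x) i≤n) (subst IsBDLabel e bl) c′ a′ t)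
  ... | vDiag refl refl e = leftOfDiag c′ a′ t
  ... | vLeftOfDiag _ _ e = ⊥-elim (bdLabel-nonempty bl e)
  ... | vNonAG x q e = trans (nonAGRow r c′ a′ (≤-trans (<⇒≤ t) b) x rn q)
          (Staircase.leftOfBD st r c a b (Q→≤n r rn q) (subst IsBDLabel e bl) c′ a′ t)
  ... | vAGDiag x q refl e = ⊥-elim (true≢false (trans (sym q) (trans (Qeq r x) (trans (cong isAGCell (sym e)) (bdLabel-notAG bl)))))
  ... | vShifted x q cr p1 cp e = trans (shifted r c′ a′ (<-trans t cr) rn q p1 (<-trans t cp))
          (Staircase.leftOfBD st (p r) c a (<⇒≤ cp) (p-n r (≤-trans a (<⇒≤ cr)) rn) (subst IsBDLabel e bl) c′ a′ t)
  ... | vShiftedEmpty x q _ _ _ e = ⊥-elim (bdLabel-nonempty bl e)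
  ... | vFirstEmpty x q _ _ _ e = ⊥-elim (bdLabel-nonempty bl e)
  ... | vFirstShifted x q cr p0 ci e = trans (firstShifted r c′ a′ (<-trans t cr) rn q p0 (≤-trans (<⇒≤ t) ci))
          (Staircase.leftOfBD st i c a ci i≤n (subst IsBDLabel e bl) c′ a′ t)

  moved-column-empty : ∀ s c r → IsAGLabel (f s c) → 1 ≤ c → c ≤ s → s ≤ n → s ≤ r →
        (∀ r′ → r < r′ → Qf r′ ≡ true → 1 ≤ p r′ → c < p r′ → s < p r′) →
        (∀ r′ → r < r′ → Qf r′ ≡ true → p r′ ≡ 0 → c ≤ i → s < i) →
        ∀ r′ → r < r′ → r′ ≤ suc n → R r′ c ≡ nothing
  moved-column-empty s c r al a cs sn sr viaPrev viaI r′ rr′ rn′ with view r′ c a (≤-trans cs (≤-trans sr (<⇒≤ rr′))) rn′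
  ... | vBelow x e = trans e (Staircase.aboveAG st s c a cs sn al r′ (≤-<-trans sr rr′) (≤-trans (<⇒≤ x) i≤n))
  ... | vDiag refl refl e = ⊥-elim (<-irrefl refl (≤-<-trans (≤-trans cs sr) rr′))
  ... | vLeftOfDiag _ _ e = e
  ... | vNonAG x q e = trans e (Staircase.aboveAG st s c a cs sn al r′ (≤-<-trans sr rr′) (Q→≤n r′ rn′ q))
  ... | vAGDiag x q refl e = ⊥-elim (<-irrefl refl (≤-<-trans (≤-trans cs sr) rr′))
  ... | vShifted x q cr p1 cp e = trans e (Staircase.aboveAG st s c a cs sn al (p r′) (viaPrev r′ rr′ q p1 cp) (p-n r′ (Q≥1 r′ q) rn′))
  ... | vShiftedEmpty x q _ _ _ e = e
  ... | vFirstEmpty x q _ _ _ e = e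
  ... | vFirstShifted x q cr p0 ci e = trans e (Staircase.aboveAG st s c a cs sn al i (viaI r′ rr′ q p0 ci) i≤n)

  -- An α/γ cell of R is either on the diagonal of a selected row, or an α/γ cell
  -- of f moved up together with its whole column segment; the column lemma
  -- applies in each case.
  aboveAG-R : ∀ r c → 1 ≤ c → c ≤ r → r ≤ suc n → IsAGLabel (R r c) → ∀ r′ → r < r′ → r′ ≤ suc n → R r′ c ≡ nothing
  aboveAG-R r c a b rn al r′ rr′ rn′ with view r c a b rn
  ... | vBelow x e = moved-column-empty r c r (subst IsAGLabel e al) a b (≤-trans (<⇒≤ x) i≤n) ≤-refl
          (λ r″ _ q p1 _ → <-trans x (p-i r″ p1)) (λ _ _ _ _ _ → x) r′ rr′ rn′
  ... | vDiag _ _ e = ⊥-elim (true≢false (trans (sym (agLabel-isAG (subst IsAGLabel e al))) y-BD))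
  ... | vLeftOfDiag _ _ e = ⊥-elim (agLabel-nonempty al e)
  ... | vNonAG x q e with c ≟ r
  ...   | yes refl = ⊥-elim (true≢false (trans (sym (agLabel-isAG (subst IsAGLabel e al))) notAG))
    where notAG = trans (cong isAGCell (sym (g-low c c (Q→≤n c rn q)))) (trans (sym (Qeq c x)) q)
  ...   | no c≢ = ⊥-elim (agLabel-nonempty (subst IsAGLabel e al) (bdRowEmpty st r c a (≤∧≢⇒< b c≢) (Q→≤n r rn q) notAG))
    where notAG = trans (cong isAGCell (sym (g-low r r (Q→≤n r rn q)))) (trans (sym (Qeq r x)) q)
  aboveAG-R r c a b rn al r′ rr′ rn′ | vAGDiag x q refl e =
    moved-column-empty r r r (subst IsAGLabel (trans e (g-low r r r≤n)) al) a ≤-refl r≤n ≤-refl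
      (λ _ _ _ _ cp → cp) (λ r″ t _ p0 _ → ⊥-elim (p-nonzero r r″ q t p0)) r′ rr′ rn′
    where
    r≤n : r ≤ n
    r≤n = ≤-pred (<-≤-trans rr′ rn′)
  aboveAG-R r c a b rn al r′ rr′ rn′ | vShifted x q cr p1 cp e =
    moved-column-empty (p r) c r (subst IsAGLabel e al) a (<⇒≤ cp) (p-n r 1≤r rn) (<⇒≤ (p-lt r 1≤r))
      (λ r″ t _ _ _ → <-≤-trans (p-lt r 1≤r) (r≤p r r″ q t))
      (λ r″ t _ p0 _ → ⊥-elim (p-nonzero r r″ q t p0)) r′ rr′ rn′
    where 1≤r = ≤-trans a (<⇒≤ cr)
  aboveAG-R r c a b rn al r′ rr′ rn′ | vShiftedEmpty x q _ _ _ e = ⊥-elim (agLabel-nonempty al e)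
  aboveAG-R r c a b rn al r′ rr′ rn′ | vFirstEmpty x q _ _ _ e = ⊥-elim (agLabel-nonempty al e)
  aboveAG-R r c a b rn al r′ rr′ rn′ | vFirstShifted x q cr p0 ci e =
    moved-column-empty i c r (subst IsAGLabel e al) a ci i≤n (<⇒≤ x)
      (λ r″ t _ _ _ → <-≤-trans x (r≤p r r″ q t))
      (λ r″ t _ p0′ _ → ⊥-elim (p-nonzero r r″ q t p0′)) r′ rr′ rn′

  staircase-R : Staircase (suc n) R
  staircase-R = record { diagFull = diag-R ; aboveAG = aboveAG-R ; leftOfBD = leftOfBD-R }

-- Row r overhangs if it is α/γ and has a label at or right of the
-- column of its previous α/γ row; in an insertion only the first α/γ row above
-- the inserted row i can overhang, its last label being in column i.  unshift
-- moves row overhangRow back to row i and every α/γ row above i down to its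
-- predecessor.

labelled : Cell → Bool
labelled nothing = false
labelled (just _) = true

labelled-true : ∀ c → (c ≡ nothing → ⊥) → labelled c ≡ true
labelled-true nothing nonempty = ⊥-elim (nonempty refl)
labelled-true (just x) _ = refl

labelled-false : ∀ c → labelled c ≡ false → c ≡ nothing
labelled-false nothing _ = refl
labelled-false (just x) ()

agRow : CellFun → ℕ → Bool
agRow h r = isAGCell (h r r)

prevAGRow : CellFun → ℕ → ℕ
prevAGRow h r = lastBelow (agRow h) (pred r)

nextAGRow : ℕ → CellFun → ℕ → ℕ
nextAGRow N h r = firstAbove (agRow h) r N

lastLabelled : CellFun → ℕ → ℕ
lastLabelled h r = lastBelow (λ c → labelled (h r c)) (pred r)

overhang : CellFun → ℕ → Bool
overhang h r = agRow h r ∧ ((prevAGRow h r ≤ᵇ lastLabelled h r) ∧ (0 <ᵇ lastLabelled h r))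

overhangRow : ℕ → CellFun → ℕ
overhangRow N h = lastBelow (overhang h) N

insertedRow : ℕ → CellFun → ℕ
insertedRow N h = lastLabelled h (overhangRow N h)

unshift : ℕ → CellFun → CellFun
unshift N h r c = if r ≡ᵇ insertedRow N h then h (overhangRow N h) c
                  else (if ((insertedRow N h <ᵇ r) ∧ agRow h r) ∧ (c <ᵇ r) then h (nextAGRow N h r) c else h r c)

unshift-inserted : ∀ N h c → unshift N h (insertedRow N h) c ≡ h (overhangRow N h) c
unshift-inserted N h c rewrite ≡ᵇ-refl (insertedRow N h) = refl

unshift-shifted : ∀ N h r c → r ≢ insertedRow N h → insertedRow N h < r → agRow h r ≡ true → c < r →
                  unshift N h r c ≡ h (nextAGRow N h r) c
unshift-shifted N h r c r≢ i<r sel c<r rewrite ≡ᵇ-≢ r (insertedRow N h) r≢ | <ᵇ-< i<r | sel | <ᵇ-< c<r = refl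

Fixed : ℕ → CellFun → ℕ → ℕ → Set
Fixed N h r c = ¬ insertedRow N h < r ⊎ agRow h r ≡ false ⊎ r ≤ c

unshift-fixed : ∀ N h r c → r ≢ insertedRow N h → Fixed N h r c → unshift N h r c ≡ h r c
unshift-fixed N h r c r≢ fixed rewrite ≡ᵇ-≢ r (insertedRow N h) r≢ = condition-false fixed
  where
  condition-false : Fixed N h r c →
    (if ((insertedRow N h <ᵇ r) ∧ agRow h r) ∧ (c <ᵇ r) then h (nextAGRow N h r) c else h r c) ≡ h r c
  condition-false (inj₁ x) rewrite <ᵇ-≮ x = refl
  condition-false (inj₂ (inj₁ x)) rewrite x | ∧-zeroʳ (insertedRow N h <ᵇ r) = refl
  condition-false (inj₂ (inj₂ x)) rewrite <ᵇ-≥ {c} {r} x | ∧-zeroʳ ((insertedRow N h <ᵇ r) ∧ agRow h r) = refl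

-- Reading the deleted element off h: y is the label of the diagonal of row i,
-- and the index is i - 1 as an element of Fin (suc m).

toBD : Cell → BD
toBD (just δ) = δᵧ
toBD _ = βᵧ

toBD-bdSym : ∀ y → toBD (just (bdSym y)) ≡ y
toBD-bdSym βᵧ = refl
toBD-bdSym δᵧ = refl

bd-toBD : ∀ {c} → IsBDLabel c → just (bdSym (toBD c)) ≡ c
bd-toBD isβ = refl
bd-toBD isδ = refl

clamp : ∀ m → ℕ → Fin (suc m)
clamp m zero = Fin.zero
clamp zero (suc k) = Fin.zero
clamp (suc m) (suc k) = Fin.suc (clamp m k)

clamp-toℕ : ∀ m (k : Fin (suc m)) → clamp m (toℕ k) ≡ k
clamp-toℕ m Fin.zero = refl
clamp-toℕ (suc m) (Fin.suc k) = cong Fin.suc (clamp-toℕ m k)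

toℕ-clamp : ∀ m k → k ≤ m → toℕ (clamp m k) ≡ k
toℕ-clamp m zero _ = refl
toℕ-clamp (suc m) (suc k) (s≤s k≤m) = cong suc (toℕ-clamp m k k≤m)

agElem : ∀ m → CellFun → AG → Elem (suc m)
agElem m h x = if overhangRow (suc (suc m)) h ≡ᵇ 0 then letter (agSym x)
               else triple x (toBD (h (insertedRow (suc (suc m)) h) (insertedRow (suc (suc m)) h))) (clamp m (insertedRow (suc (suc m)) h ∸ 1))

agElem-letter : ∀ m h x → overhangRow (suc (suc m)) h ≡ 0 → agElem m h x ≡ letter (agSym x)
agElem-letter m h x none rewrite none = refl

agElem-triple : ∀ m h x → 1 ≤ overhangRow (suc (suc m)) h → agElem m h x ≡
  triple x (toBD (h (insertedRow (suc (suc m)) h) (insertedRow (suc (suc m)) h))) (clamp m (insertedRow (suc (suc m)) h ∸ 1))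
agElem-triple m h x 1≤ rewrite ≡ᵇ-≢ (overhangRow (suc (suc m)) h) 0 (λ eq → <-irrefl (sym eq) 1≤) = refl

deletedElem : ∀ m → CellFun → Cell → Elem (suc m)
deletedElem m h (just α) = agElem m h αₓ
deletedElem m h (just γ) = agElem m h γₓ
deletedElem m h (just β) = letter β
deletedElem m h (just δ) = letter δ
deletedElem m h nothing = letter β

deletedFun : ℕ → CellFun → Cell → CellFun
deletedFun N h (just α) = unshift N h
deletedFun N h (just γ) = unshift N h
deletedFun N h _ = h

deletion : ∀ m → Filling (suc (suc m)) → Filling (suc m) × Elem (suc m)
deletion m T′ = build (suc m) (deletedFun (suc (suc m)) (get T′) (get T′ (suc (suc m)) (suc (suc m))))
              , deletedElem m (get T′) (get T′ (suc (suc m)) (suc (suc m)))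

deletion-top : ∀ m (T′ : Filling (suc (suc m))) (c : Cell) → get T′ (suc (suc m)) (suc (suc m)) ≡ c →
  deletion m T′ ≡ (build (suc m) (deletedFun (suc (suc m)) (get T′) c) , deletedElem m (get T′) c)
deletion-top m T′ .(get T′ (suc (suc m)) (suc (suc m))) refl = refl

-- Let h agree on the shape with an α/γ insertion R
-- into the staircase f (inserted row i, i = 0 for a letter).  Then the α/γ rows
-- of h above i are the selected rows of the insertion, the overhanging row of h
-- is r0 (none if i = 0), the inserted row read off h is i, and unshift h gives
-- back f.
module LeftInverse (n : ℕ) (f : CellFun) (z : Sym) (i : ℕ) (y : Sym) (R : CellFun) (S : InsertionShape n f z i y R)
                   (z-AG : isAG z ≡ true) (i≤n : i ≤ n) (st : Staircase n f)
                   (h : CellFun) (hR : ∀ r c → 1 ≤ c → c ≤ r → r ≤ suc n → h r c ≡ R r c) where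
  open ShapeView n f z i y R S z-AG i≤n
  open FirstAGAbove n z f i z-AG i≤n using (r0; prev-r0; r0-selected; r0≤; i<r0)
  N = suc n

  agRow-h : ∀ r → i < r → r ≤ N → agRow h r ≡ Qf r
  agRow-h r i<r rn with Qf r in sel
  ... | true = trans (cong isAGCell (trans (hR r r 1≤r ≤-refl rn) (agDiag r 1≤r rn sel))) (trans (sym (Qeq r i<r)) sel)
    where 1≤r = ≤-<-trans z≤n i<r
  ... | false = trans (cong isAGCell (trans (hR r r 1≤r ≤-refl rn)
                        (trans (nonAGRow r r 1≤r ≤-refl i<r rn sel) (sym (g-low r r (Q→≤n r rn sel))))))
                      (trans (sym (Qeq r i<r)) sel)
    where 1≤r = ≤-<-trans z≤n i<r

  top-diag : h N N ≡ just z
  top-diag = trans (hR N N (s≤s z≤n) ≤-refl ≤-refl) (trans (agDiag N (s≤s z≤n) ≤-refl Qtop) (addRow-top n z f))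

  p≤N : ∀ r → r ≤ N → p r ≤ N
  p≤N r rn = ≤-trans (lastBelow-≤ Qf (pred r)) (≤-trans pred[n]≤n rn)

  prevAGRow-h : ∀ r → i < r → r ≤ N → Qf r ≡ true → 1 ≤ p r → prevAGRow h r ≡ p r
  prevAGRow-h r i<r rn sel p1 = lastBelow-char (agRow h) (pred r) (p r) (lastBelow-≤ Qf (pred r))
     (trans (agRow-h (p r) (p-i r p1) (p≤N r rn)) (p-Q r p1))
     (λ t a b → trans (agRow-h t (<-trans (p-i r p1) a) (≤-trans b (≤-trans pred[n]≤n rn))) (lastBelow-max Qf (pred r) t a b))

  -- A shifted row has no label from column p r on, so it does not overhang.
  lastLabelled-shifted : ∀ r → i < r → r ≤ N → Qf r ≡ true → 1 ≤ p r → lastLabelled h r < p r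
  lastLabelled-shifted r i<r rn sel p1 =
    <-≤-trans (s≤s (lastBelow-bounded (λ c → labelled (h r c)) (pred r) (pred (p r)) empty))
              (≤-reflexive (suc-pred′ (p r) p1))
    where
    empty : ∀ c → pred (p r) < c → c ≤ pred r → labelled (h r c) ≡ false
    empty c a b = cong labelled (trans (hR r c 1≤c (≤-trans b pred[n]≤n) rn)
                    (shiftedEmpty r c 1≤c (≤pred⇒< b (≤-trans 1≤c (≤-trans b pred[n]≤n))) rn sel p1 p≤c))
      where
      1≤c : 1 ≤ c
      1≤c = ≤-<-trans z≤n a
      p≤c : p r ≤ c
      p≤c = subst (_≤ c) (suc-pred′ (p r) p1) a

  no-overhang-shifted : ∀ r → i < r → r ≤ N → Qf r ≡ true → 1 ≤ p r → overhang h r ≡ false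
  no-overhang-shifted r i<r rn sel p1
    rewrite prevAGRow-h r i<r rn sel p1 | ≤ᵇ-> (lastLabelled-shifted r i<r rn sel p1) = ∧-zeroʳ _

  lastLabelled-first : i ≡ 0 → ∀ r → r ≤ N → Qf r ≡ true → p r ≡ 0 → lastLabelled h r ≡ 0
  lastLabelled-first i0 r rn sel p0 = lastBelow-none (λ c → labelled (h r c)) (pred r) (λ c a b →
     cong labelled (trans (hR r c a (≤-trans b pred[n]≤n) rn)
       (firstEmpty r c a (≤pred⇒< b (≤-trans a (≤-trans b pred[n]≤n))) rn sel p0 (subst (_< c) (sym i0) a))))

  no-overhang-first : i ≡ 0 → ∀ r → r ≤ N → Qf r ≡ true → p r ≡ 0 → overhang h r ≡ false
  no-overhang-first i0 r rn sel p0 rewrite lastLabelled-first i0 r rn sel p0 = trans (cong (agRow h r ∧_) (∧-zeroʳ _)) (∧-zeroʳ _)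

  -- For a triple, r0 carries row i of f, whose last label is its diagonal.
  lastLabelled-r0 : 1 ≤ i → lastLabelled h r0 ≡ i
  lastLabelled-r0 1≤i = lastBelow-char (λ c → labelled (h r0 c)) (pred r0) i (<⇒≤pred i<r0)
    (labelled-true _ (λ e → Staircase.diagFull st i 1≤i i≤n (trans (sym (firstShifted r0 i 1≤i i<r0 r0≤ r0-selected prev-r0 ≤-refl))
                                (trans (sym (hR r0 i 1≤i (<⇒≤ i<r0) r0≤)) e))))
    (λ c a b → cong labelled (trans (hR r0 c (≤-trans 1≤i (<⇒≤ a)) (≤-trans b pred[n]≤n) r0≤)
                 (firstEmpty r0 c (≤-trans 1≤i (<⇒≤ a)) (≤pred⇒< b (≤-<-trans z≤n i<r0)) r0≤ r0-selected prev-r0 a)))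

  prevAGRow-r0≤i : prevAGRow h r0 ≤ i
  prevAGRow-r0≤i = lastBelow-bounded (agRow h) (pred r0) i (λ t a b →
      trans (agRow-h t a (≤-trans b (≤-trans pred[n]≤n r0≤)))
        (lastBelow-max Qf (pred r0) t (subst (_< t) (sym prev-r0) (≤-<-trans z≤n a)) b))

  overhang-r0 : 1 ≤ i → overhang h r0 ≡ true
  overhang-r0 1≤i rewrite agRow-h r0 i<r0 r0≤ | r0-selected | lastLabelled-r0 1≤i | ≤ᵇ-≤ prevAGRow-r0≤i | <ᵇ-< 1≤i = refl

  no-overhang-above : ∀ r → 0 < r → r ≤ N → (1 ≤ i → r0 < r) → overhang h r ≡ false
  no-overhang-above r 0<r rn above with agRow h r in isAG-r
  ... | false = refl
  ... | true = subst (λ b → (b ∧ ((prevAGRow h r ≤ᵇ lastLabelled h r) ∧ (0 <ᵇ lastLabelled h r))) ≡ false) isAG-r notOverhang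
    where
    i<r : i < r
    i<r with i ≟ 0
    ... | yes i0 = subst (_< r) (sym i0) 0<r
    ... | no i≢0 = <-trans i<r0 (above (n≢0⇒n>0 i≢0))
    sel : Qf r ≡ true
    sel = trans (sym (agRow-h r i<r rn)) isAG-r
    notOverhang : overhang h r ≡ false
    notOverhang with p r ≟ 0
    ... | no p≢0 = no-overhang-shifted r i<r rn sel (n≢0⇒n>0 p≢0)
    ... | yes p0 with i ≟ 0
    ...   | yes i0 = no-overhang-first i0 r rn sel p0
    ...   | no i≢0 = ⊥-elim (p-nonzero r0 r r0-selected (above (n≢0⇒n>0 i≢0)) p0)

  overhangRow≡r0 : 1 ≤ i → overhangRow N h ≡ r0
  overhangRow≡r0 1≤i = lastBelow-char (overhang h) N r0 r0≤ (overhang-r0 1≤i) (λ r a b → no-overhang-above r (≤-<-trans z≤n a) b (λ _ → a))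

  overhangRow≡0 : i ≡ 0 → overhangRow N h ≡ 0
  overhangRow≡0 i0 = lastBelow-none (overhang h) N (λ r a b → no-overhang-above r a b (λ 1≤i → ⊥-elim (<-irrefl (sym i0) 1≤i)))

  insertedRow≡i : insertedRow N h ≡ i
  insertedRow≡i with i ≟ 0
  ... | yes i0 = trans (cong (lastLabelled h) (overhangRow≡0 i0)) (sym i0)
  ... | no i≢0 = trans (cong (lastLabelled h) (overhangRow≡r0 (n≢0⇒n>0 i≢0))) (lastLabelled-r0 (n≢0⇒n>0 i≢0))

  -- The next α/γ row of h after a selected row r ≤ n is the row s with p s = r,
  -- which holds the cells of row r left of the diagonal.
  unshift-above : ∀ r c → 1 ≤ c → c ≤ r → r ≤ n → i < r → r ≢ insertedRow N h → ∀ b → agRow h r ≡ b → unshift N h r c ≡ f r c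
  unshift-above r c a b rn i<r r≢ false notAG = trans (unshift-fixed N h r c r≢ (inj₂ (inj₁ notAG)))
    (trans (hR r c a b (≤-trans rn (n≤1+n n))) (nonAGRow r c a b i<r rN (trans (sym (agRow-h r i<r rN)) notAG)))
    where rN = ≤-trans rn (n≤1+n n)
  unshift-above r c a b rn i<r r≢ true isAG-r with c ≟ r
  ... | yes refl = trans (unshift-fixed N h c c r≢ (inj₂ (inj₂ ≤-refl)))
                     (trans (hR c c a b rN) (trans (agDiag c a rN (trans (sym (agRow-h c i<r rN)) isAG-r)) (g-low c c rn)))
    where rN = ≤-trans rn (n≤1+n n)
  ... | no c≢ = trans (unshift-shifted N h r c r≢ (subst (_< r) (sym insertedRow≡i) i<r) isAG-r c<r)
                (trans (hR s c a (<⇒≤ (<-trans c<r r<s)) s≤N)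
                (trans (shifted s c a (<-trans c<r r<s) s≤N sel-s (subst (1 ≤_) (sym ps≡r) (≤-trans a b)) (subst (c <_) (sym ps≡r) c<r))
                  (cong (λ w → f w c) ps≡r)))
    where
    rN = ≤-trans rn (n≤1+n n)
    c<r = ≤∧≢⇒< b c≢
    next = firstAbove-exists (agRow h) r N N (s≤s rn) ≤-refl (trans (cong isAGCell top-diag) z-AG)
    s = nextAGRow N h r
    r<s : r < s
    r<s = proj₁ next
    s≤N : s ≤ N
    s≤N = proj₁ (proj₂ next)
    sel-s : Qf s ≡ true
    sel-s = trans (sym (agRow-h s (<-trans i<r r<s) s≤N)) (proj₁ (proj₂ (proj₂ next)))
    ps≡r : p s ≡ r
    ps≡r = lastBelow-char Qf (pred s) r (<⇒≤pred r<s) (trans (sym (agRow-h r i<r rN)) isAG-r)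
          (λ t u v → trans (sym (agRow-h t (<-trans i<r u) (≤-trans v (≤-trans pred[n]≤n s≤N))))
                       (proj₂ (proj₂ (proj₂ next)) t u (≤pred⇒< v (≤-<-trans z≤n r<s))))

  unshift-recovers : ∀ r c → 1 ≤ c → c ≤ r → r ≤ n → unshift N h r c ≡ f r c
  unshift-recovers r c a b rn with r ≟ i
  ... | yes refl = begin
    unshift N h r c          ≡⟨ cong (λ w → unshift N h w c) (sym insertedRow≡i) ⟩
    unshift N h (insertedRow N h) c ≡⟨ unshift-inserted N h c ⟩
    h (overhangRow N h) c    ≡⟨ cong (λ w → h w c) (overhangRow≡r0 (≤-trans a b)) ⟩
    h r0 c                   ≡⟨ hR r0 c a (<⇒≤ (≤-<-trans b i<r0)) r0≤ ⟩
    R r0 c                   ≡⟨ firstShifted r0 c a (≤-<-trans b i<r0) r0≤ r0-selected prev-r0 b ⟩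
    f r c                    ∎
    where open ≡-Reasoning
  ... | no r≢i with <-cmp r i
  ...   | tri< r<i _ _ = trans (unshift-fixed N h r c r≢ (inj₁ (λ i<r → <-asym r<i (subst (_< r) insertedRow≡i i<r))))
                        (trans (hR r c a b (≤-trans rn (n≤1+n n))) (below r c a b r<i))
    where r≢ = λ e → r≢i (trans e insertedRow≡i)
  ...   | tri≈ _ r≡i _ = ⊥-elim (r≢i r≡i)
  ...   | tri> _ _ i<r = unshift-above r c a b rn i<r (λ e → r≢i (trans e insertedRow≡i)) (agRow h r) refl

-- Let h be a staircase of size N = n+1 whose top diagonal is an
-- α/γ label z.  Write rs for its overhanging row and i for the inserted row
-- read off h (rs = i = 0 if no row overhangs).  Between rows i and rs there is
-- no α/γ row, row i is β/δ, and rows above rs do not overhang.  From this,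
-- unshift h is a staircase of size n, and inserting into it (z, h i i, i)
-- (or the letter z) gives back h.
module Unshifting (n : ℕ) (h : CellFun) (sth : Staircase (suc n) h) (z : Sym) (z-AG : isAG z ≡ true)
                  (top-z : h (suc n) (suc n) ≡ just z) where
  N = suc n
  rs = overhangRow N h
  i = insertedRow N h

  overhang-true : ∀ r → overhang h r ≡ true →
       (agRow h r ≡ true) × (prevAGRow h r ≤ lastLabelled h r) × (0 < lastLabelled h r)
  overhang-true r ov with agRow h r in e1 | prevAGRow h r ≤ᵇ lastLabelled h r in e2 | 0 <ᵇ lastLabelled h r in e3
  ... | true | true | true = refl , ≤ᵇ⇒≤ (prevAGRow h r) (lastLabelled h r) (subst T (sym e2) tt) , <ᵇ⇒<′ 0 (lastLabelled h r) e3
  ... | true | true | false = ⊥-elim (true≢false (sym ov))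
  ... | true | false | _ = ⊥-elim (true≢false (sym ov))
  ... | false | _ | _ = ⊥-elim (true≢false (sym ov))

  overhang-false : ∀ r → agRow h r ≡ true → overhang h r ≡ false → lastLabelled h r < prevAGRow h r ⊎ lastLabelled h r ≡ 0
  overhang-false r isAG-r notOv with prevAGRow h r ≤? lastLabelled h r
  ... | no p≰ = inj₁ (≰⇒> p≰)
  ... | yes p≤ with lastLabelled h r ≟ 0
  ...   | yes l0 = inj₂ l0
  ...   | no l≢0 = ⊥-elim (true≢false (trans (sym ov) notOv))
    where
    ov : overhang h r ≡ true
    ov rewrite isAG-r | ≤ᵇ-≤ p≤ | <ᵇ-< (n≢0⇒n>0 l≢0) = refl

  rs≤ : rs ≤ N
  rs≤ = lastBelow-≤ (overhang h) N

  rs-overhangs : 1 ≤ rs → (agRow h rs ≡ true) × (prevAGRow h rs ≤ i) × (0 < i)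
  rs-overhangs 1≤rs = overhang-true rs (lastBelow-holds (overhang h) N 1≤rs)

  no-overhang-above-rs : ∀ r → rs < r → r ≤ N → overhang h r ≡ false
  no-overhang-above-rs = lastBelow-max (overhang h) N

  i<rs : 1 ≤ rs → i < rs
  i<rs 1≤rs = ≤pred⇒< (lastBelow-≤ (λ c → labelled (h rs c)) (pred rs)) 1≤rs

  1≤rs : 1 ≤ i → 1 ≤ rs
  1≤rs 1≤i with rs ≟ 0
  ... | no rs≢0 = n≢0⇒n>0 rs≢0
  ... | yes rs≡0 = ⊥-elim (<-irrefl (sym (cong (lastLabelled h) rs≡0)) 1≤i)

  i≤n : i ≤ n
  i≤n with i ≟ 0
  ... | yes i0 = subst (_≤ n) (sym i0) z≤n
  ... | no i≢0 = ≤-pred (<-≤-trans (i<rs (1≤rs (n≢0⇒n>0 i≢0))) rs≤)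

  h-rs-i : 1 ≤ rs → h rs i ≡ nothing → ⊥
  h-rs-i 1≤rs e = true≢false (trans (sym (lastBelow-holds (λ c → labelled (h rs c)) (pred rs) (proj₂ (proj₂ (rs-overhangs 1≤rs))))) (cong labelled e))

  h-rs-right : 1 ≤ rs → ∀ c → i < c → c < rs → h rs c ≡ nothing
  h-rs-right 1≤rs c i<c c<rs = labelled-false _ (lastBelow-max (λ c → labelled (h rs c)) (pred rs) c i<c (<⇒≤pred c<rs))

  -- No α/γ row in [i, rs): for row i, an α/γ diagonal would empty (rs, i).
  notAG-between : 1 ≤ rs → ∀ t → i ≤ t → t < rs → agRow h t ≡ false
  notAG-between 1≤rs t i≤t t<rs with i ≟ t
  ... | no i≢t = lastBelow-max (agRow h) (pred rs) t (≤-<-trans (proj₁ (proj₂ (rs-overhangs 1≤rs))) (≤∧≢⇒< i≤t i≢t)) (<⇒≤pred t<rs)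
  ... | yes refl with agRow h i in isAG-i
  ...   | false = refl
  ...   | true = ⊥-elim (h-rs-i 1≤rs (Staircase.aboveAG sth i i (proj₂ (proj₂ (rs-overhangs 1≤rs))) ≤-refl (<⇒≤ (<-≤-trans t<rs rs≤))
                   (isAG-agLabel (h i i) isAG-i) rs t<rs rs≤))

  diag-i-BD : 1 ≤ rs → IsBDLabel (h i i)
  diag-i-BD 1≤rs = notAG-bdLabel (h i i) (Staircase.diagFull sth i (proj₂ (proj₂ (rs-overhangs 1≤rs))) (<⇒≤ (<-≤-trans (i<rs 1≤rs) rs≤)))
                     (notAG-between 1≤rs i ≤-refl (i<rs 1≤rs))

  next-spec : ∀ r → r ≤ n → IsFirstAbove (agRow h) r N (nextAGRow N h r)
  next-spec r rn = firstAbove-exists (agRow h) r N N (s≤s rn) ≤-refl (trans (cong isAGCell top-z) z-AG)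

  unshifted = unshift N h

  data UnshiftView (r c : ℕ) : Set where
    uInserted : r ≡ i → unshifted r c ≡ h rs c → UnshiftView r c
    uShifted  : r ≢ i → i < r → agRow h r ≡ true → c < r → unshifted r c ≡ h (nextAGRow N h r) c → UnshiftView r c
    uFixed    : r ≢ i → Fixed N h r c → unshifted r c ≡ h r c → UnshiftView r c

  unshiftView : ∀ r c → UnshiftView r c
  unshiftView r c with r ≟ i
  ... | yes refl = uInserted refl (unshift-inserted N h c)
  ... | no r≢ with i <? r
  ...   | no i≮r = uFixed r≢ (inj₁ i≮r) (unshift-fixed N h r c r≢ (inj₁ i≮r))
  ...   | yes i<r with agRow h r in isAG-r | c <? r
  ...     | false | _ = uFixed r≢ (inj₂ (inj₁ isAG-r)) (unshift-fixed N h r c r≢ (inj₂ (inj₁ isAG-r)))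
  ...     | true | yes c<r = uShifted r≢ i<r isAG-r c<r (unshift-shifted N h r c r≢ i<r isAG-r c<r)
  ...     | true | no c≮r = uFixed r≢ (inj₂ (inj₂ (≮⇒≥ c≮r))) (unshift-fixed N h r c r≢ (inj₂ (inj₂ (≮⇒≥ c≮r))))

  nN : ∀ {r} → r ≤ n → r ≤ N
  nN rn = ≤-trans rn (n≤1+n n)

  diag-T : ∀ r → 1 ≤ r → r ≤ n → unshifted r r ≡ nothing → ⊥
  diag-T r a rn e with unshiftView r r
  ... | uInserted refl e′ = h-rs-i (1≤rs a) (trans (sym e′) e)
  ... | uShifted _ _ _ r<r _ = <-irrefl refl r<r
  ... | uFixed _ _ e′ = Staircase.diagFull sth r a (nN rn) (trans (sym e′) e)

  leftOfBD-T : ∀ r c → 1 ≤ c → c ≤ r → r ≤ n → IsBDLabel (unshifted r c) → ∀ c′ → 1 ≤ c′ → c′ < c → unshifted r c′ ≡ nothing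
  leftOfBD-T r c a b rn bl c′ a′ c′<c with unshiftView r c
  ... | uInserted refl e = trans (unshift-inserted N h c′)
          (Staircase.leftOfBD sth rs c a (<⇒≤ (≤-<-trans b (i<rs (1≤rs (≤-trans a b))))) rs≤ (subst IsBDLabel e bl) c′ a′ c′<c)
  ... | uShifted r≢ i<r isAG-r c<r e = trans (unshift-shifted N h r c′ r≢ i<r isAG-r (<-trans c′<c c<r))
          (Staircase.leftOfBD sth (nextAGRow N h r) c a (<⇒≤ (<-trans c<r (proj₁ (next-spec r rn)))) (proj₁ (proj₂ (next-spec r rn)))
            (subst IsBDLabel e bl) c′ a′ c′<c)
  ... | uFixed r≢ fixed e = trans (unshift-fixed N h r c′ r≢ (fixed′ fixed))
          (Staircase.leftOfBD sth r c a b (nN rn) (subst IsBDLabel e bl) c′ a′ c′<c)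
    where
    fixed′ : Fixed N h r c → Fixed N h r c′
    fixed′ (inj₁ x) = inj₁ x
    fixed′ (inj₂ (inj₁ x)) = inj₂ (inj₁ x)
    fixed′ (inj₂ (inj₂ x)) = inj₂ (inj₁ (subst (λ w → isAGCell (h r w) ≡ false) (≤-antisym b x) (bdLabel-notAG (subst IsBDLabel e bl))))

  -- Column c of unshifted is empty above row r when (r, c) holds an α/γ label of
  -- h: every row r′ > r takes column c from a row of h above the source of
  -- (r, c), or from a β/δ row between, or is empty.
  clear-above-fixed : ∀ r c → 1 ≤ c → c ≤ r → r ≤ n → IsAGLabel (h r c) → ∀ r′ → r < r′ → r′ ≤ n → unshifted r′ c ≡ nothing
  clear-above-fixed r c a b rn al r′ r<r′ rn′ with unshiftView r′ c
  ... | uInserted refl e′ = trans e′ (Staircase.aboveAG sth r c a b (nN rn) al rs (<-trans r<r′ (i<rs (1≤rs (≤-trans a (≤-trans b (<⇒≤ r<r′)))))) rs≤)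
  ... | uShifted _ _ _ _ e′ = trans e′ (Staircase.aboveAG sth r c a b (nN rn) al (nextAGRow N h r′)
                                 (<-trans r<r′ (proj₁ (next-spec r′ rn′))) (proj₁ (proj₂ (next-spec r′ rn′))))
  ... | uFixed _ _ e′ = trans e′ (Staircase.aboveAG sth r c a b (nN rn) al r′ r<r′ (nN rn′))

  clear-above-overhang : ∀ c → 1 ≤ c → c ≤ i → IsAGLabel (h rs c) → ∀ r′ → i < r′ → r′ ≤ n → unshifted r′ c ≡ nothing
  clear-above-overhang c a c≤i al r′ i<r′ rn′ = target (unshiftView r′ c)
    where
    1≤rs′ = 1≤rs (≤-trans a c≤i)
    c≤rs : c ≤ rs
    c≤rs = <⇒≤ (≤-<-trans c≤i (i<rs 1≤rs′))
    target : UnshiftView r′ c → unshifted r′ c ≡ nothing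
    target (uInserted refl e′) = ⊥-elim (<-irrefl refl i<r′)
    target (uShifted _ _ isAG-r′ _ e′) = trans e′ (Staircase.aboveAG sth rs c a c≤rs rs≤ al (nextAGRow N h r′)
                                           (≤-<-trans rs≤r′ (proj₁ (next-spec r′ rn′))) (proj₁ (proj₂ (next-spec r′ rn′))))
      where
      rs≤r′ : rs ≤ r′
      rs≤r′ with r′ <? rs
      ... | yes r′<rs = ⊥-elim (true≢false (trans (sym isAG-r′) (notAG-between 1≤rs′ r′ (<⇒≤ i<r′) r′<rs)))
      ... | no r′≮rs = ≮⇒≥ r′≮rs
    target (uFixed _ fixed e′) with <-cmp r′ rs
    ... | tri> _ _ rs<r′ = trans e′ (Staircase.aboveAG sth rs c a c≤rs rs≤ al r′ rs<r′ (nN rn′))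
    ... | tri< r′<rs _ _ = trans e′ (bdRowEmpty sth r′ c a (≤-<-trans c≤i i<r′) (nN rn′) (notAG-between 1≤rs′ r′ (<⇒≤ i<r′) r′<rs))
    ... | tri≈ _ refl _ with fixed
    ...   | inj₁ i≮r′ = ⊥-elim (i≮r′ i<r′)
    ...   | inj₂ (inj₁ notAG) = ⊥-elim (true≢false (trans (sym (proj₁ (rs-overhangs 1≤rs′))) notAG))
    ...   | inj₂ (inj₂ r′≤c) = ⊥-elim (<-irrefl refl (≤-<-trans r′≤c (≤-<-trans c≤i i<r′)))

  clear-above-next : ∀ r c → 1 ≤ c → c < r → r ≤ n → i < r → IsAGLabel (h (nextAGRow N h r) c) →
                     ∀ r′ → r < r′ → r′ ≤ n → unshifted r′ c ≡ nothing
  clear-above-next r c a c<r rn i<r al r′ r<r′ rn′ = target (unshiftView r′ c)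
    where
    s = nextAGRow N h r
    r<s : r < s
    r<s = proj₁ (next-spec r rn)
    s≤N : s ≤ N
    s≤N = proj₁ (proj₂ (next-spec r rn))
    c≤s : c ≤ s
    c≤s = <⇒≤ (<-trans c<r r<s)
    none-between : ∀ t → r < t → t < s → agRow h t ≡ false
    none-between = proj₂ (proj₂ (proj₂ (next-spec r rn)))
    target : UnshiftView r′ c → unshifted r′ c ≡ nothing
    target (uInserted refl e′) = ⊥-elim (<-asym i<r r<r′)
    target (uShifted _ _ isAG-r′ _ e′) = trans e′ (Staircase.aboveAG sth s c a c≤s s≤N al (nextAGRow N h r′)
                                           (≤-<-trans s≤r′ (proj₁ (next-spec r′ rn′))) (proj₁ (proj₂ (next-spec r′ rn′))))
      where
      s≤r′ : s ≤ r′
      s≤r′ with r′ <? s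
      ... | yes r′<s = ⊥-elim (true≢false (trans (sym isAG-r′) (none-between r′ r<r′ r′<s)))
      ... | no r′≮s = ≮⇒≥ r′≮s
    target (uFixed _ fixed e′) with <-cmp r′ s
    ... | tri> _ _ s<r′ = trans e′ (Staircase.aboveAG sth s c a c≤s s≤N al r′ s<r′ (nN rn′))
    ... | tri< r′<s _ _ = trans e′ (bdRowEmpty sth r′ c a (<-trans c<r r<r′) (nN rn′) (none-between r′ r<r′ r′<s))
    ... | tri≈ _ refl _ with fixed
    ...   | inj₁ i≮r′ = ⊥-elim (i≮r′ (<-trans i<r r<s))
    ...   | inj₂ (inj₁ notAG) = ⊥-elim (true≢false (trans (sym (proj₁ (proj₂ (proj₂ (next-spec r rn))))) notAG))
    ...   | inj₂ (inj₂ r′≤c) = ⊥-elim (<-irrefl refl (≤-<-trans r′≤c (<-trans c<r r<s)))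

  aboveAG-T : ∀ r c → 1 ≤ c → c ≤ r → r ≤ n → IsAGLabel (unshifted r c) → ∀ r′ → r < r′ → r′ ≤ n → unshifted r′ c ≡ nothing
  aboveAG-T r c a b rn al with unshiftView r c
  ... | uInserted refl e = clear-above-overhang c a b (subst IsAGLabel e al)
  ... | uShifted _ i<r _ c<r e = clear-above-next r c a c<r rn i<r (subst IsAGLabel e al)
  ... | uFixed _ _ e = clear-above-fixed r c a b rn (subst IsAGLabel e al)

  staircase-unshifted : Staircase n unshifted
  staircase-unshifted = record { diagFull = diag-T ; aboveAG = aboveAG-T ; leftOfBD = leftOfBD-T }

  f₀ = get (build n unshifted)

  f₀-eq : ∀ r c → 1 ≤ c → c ≤ r → r ≤ n → f₀ r c ≡ unshifted r c
  f₀-eq = get-build n unshifted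

  -- Any insertion R′ of z into f₀ at row i, whose diagonal label y at row i is
  -- that of h, coincides with h: the selected rows of the insertion are the α/γ
  -- rows of h above i, and each InsertionShape case is matched by h.
  module Reinsert (y : Sym) (R′ : CellFun) (S′ : InsertionShape n f₀ z i y R′)
                  (y≡ : 1 ≤ i → just y ≡ h i i) where
    open ShapeView n f₀ z i y R′ S′ z-AG i≤n

    Qf≡agRow : ∀ r → i < r → r ≤ N → Qf r ≡ agRow h r
    Qf≡agRow r i<r rN with r ≟ N
    ... | yes refl = trans (Qeq r i<r) (trans (cong isAGCell (addRow-top n z f₀)) (cong isAGCell (sym top-z)))
    ... | no r≢ = trans (Qeq r i<r) (cong isAGCell (trans (g-low r r rn) (trans (f₀-eq r r (≤-<-trans z≤n i<r) ≤-refl rn)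
                      (unshift-fixed N h r r (λ e → <-irrefl (sym e) i<r) (inj₂ (inj₂ ≤-refl))))))
      where rn = ≤-pred (≤∧≢⇒< rN r≢)

    agRow-h : ∀ r → i < r → r ≤ N → Qf r ≡ true → agRow h r ≡ true
    agRow-h r i<r rN sel = trans (sym (Qf≡agRow r i<r rN)) sel

    prevAGRow≡p : ∀ r → i < r → r ≤ N → 1 ≤ p r → prevAGRow h r ≡ p r
    prevAGRow≡p r i<r rN p1 = lastBelow-char (agRow h) (pred r) (p r) (lastBelow-≤ Qf (pred r))
       (agRow-h (p r) (p-i r p1) (≤-trans (<⇒≤ (p-lt r (≤-<-trans z≤n i<r))) rN) (p-Q r p1))
       (λ t u v → trans (sym (Qf≡agRow t (<-trans (p-i r p1) u) (≤-trans v (≤-trans pred[n]≤n rN)))) (lastBelow-max Qf (pred r) t u v))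

    first≡rs : ∀ r → i < r → r ≤ N → Qf r ≡ true → p r ≡ 0 → 1 ≤ rs → r ≡ rs
    first≡rs r i<r rN sel p0 1≤rs with <-cmp r rs
    ... | tri≈ _ r≡rs _ = r≡rs
    ... | tri< r<rs _ _ = ⊥-elim (true≢false (trans (sym (agRow-h r i<r rN sel)) (notAG-between 1≤rs r (<⇒≤ i<r) r<rs)))
    ... | tri> _ _ rs<r = ⊥-elim (p-nonzero rs r (trans (Qf≡agRow rs (i<rs 1≤rs) rs≤) (proj₁ (rs-overhangs 1≤rs))) rs<r p0)

    rs<shifted : ∀ r → i < r → r ≤ N → Qf r ≡ true → 1 ≤ p r → rs < r
    rs<shifted r i<r rN sel p1 with rs ≟ 0
    ... | yes rs≡0 = subst (_< r) (sym rs≡0) (≤-<-trans z≤n i<r)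
    ... | no rs≢0 with <-cmp r rs
    ...   | tri< r<rs _ _ = ⊥-elim (true≢false (trans (sym (agRow-h r i<r rN sel)) (notAG-between (n≢0⇒n>0 rs≢0) r (<⇒≤ i<r) r<rs)))
    ...   | tri> _ _ rs<r = rs<r
    ...   | tri≈ _ refl _ = ⊥-elim (true≢false (trans (sym (agRow-h (p r) (p-i r p1) (≤-trans (<⇒≤ (p-lt r (≤-<-trans z≤n i<r))) rN) (p-Q r p1)))
                              (notAG-between (n≢0⇒n>0 rs≢0) (p r) (<⇒≤ (p-i r p1)) (p-lt r (≤-<-trans z≤n i<r)))))

    emptyAfterLast : ∀ r c → c < r → lastLabelled h r < c → h r c ≡ nothing
    emptyAfterLast r c c<r l<c = labelled-false _ (lastBelow-max (λ c → labelled (h r c)) (pred r) c l<c (<⇒≤pred c<r))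

    -- A shifted row of the insertion reads the next α/γ row after p r, i.e. r.
    reinsert-shifted : ∀ r c → 1 ≤ c → i < r → r ≤ N → Qf r ≡ true → 1 ≤ p r → c < p r → f₀ (p r) c ≡ h r c
    reinsert-shifted r c a i<r rN sel p1 c<p =
      trans (f₀-eq (p r) c a (<⇒≤ c<p) pn)
        (trans (unshift-shifted N h (p r) c (λ e → <-irrefl (sym e) (p-i r p1)) (p-i r p1) (agRow-h (p r) (p-i r p1) (nN pn) (p-Q r p1)) c<p)
          (cong (λ w → h w c) next≡r))
      where
      1≤r = ≤-<-trans z≤n i<r
      pn = p-n r 1≤r rN
      next≡r : nextAGRow N h (p r) ≡ r
      next≡r = firstAbove-char (agRow h) (p r) N r (p-lt r 1≤r) rN (agRow-h r i<r rN sel)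
             (λ t u v → trans (sym (Qf≡agRow t (<-trans (p-i r p1) u) (≤-trans (<⇒≤ v) rN))) (lastBelow-max Qf (pred r) t u (<⇒≤pred v)))

    -- A shifted row does not overhang, so h is empty from column p r on.
    reinsert-shiftedEmpty : ∀ r c → i < r → r ≤ N → Qf r ≡ true → 1 ≤ p r → p r ≤ c → c < r → h r c ≡ nothing
    reinsert-shiftedEmpty r c i<r rN sel p1 p≤c c<r = emptyAfterLast r c c<r (<-≤-trans last<p p≤c)
      where
      last<p : lastLabelled h r < p r
      last<p with overhang-false r (agRow-h r i<r rN sel) (no-overhang-above-rs r (rs<shifted r i<r rN sel p1) rN)
      ... | inj₁ x = subst (lastLabelled h r <_) (prevAGRow≡p r i<r rN p1) x
      ... | inj₂ x = subst (_< p r) (sym x) p1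

    -- The first selected row is empty right of column i: it is rs when i ≥ 1, and
    -- for i = 0 it has no previous α/γ row and does not overhang.
    reinsert-firstEmpty : ∀ r c → 1 ≤ c → i < r → r ≤ N → Qf r ≡ true → p r ≡ 0 → i < c → c < r → h r c ≡ nothing
    reinsert-firstEmpty r c a i<r rN sel p0 i<c c<r with rs ≟ 0
    ... | no rs≢0 = trans (cong (λ w → h w c) r≡rs) (h-rs-right (n≢0⇒n>0 rs≢0) c i<c (subst (c <_) r≡rs c<r))
      where r≡rs = first≡rs r i<r rN sel p0 (n≢0⇒n>0 rs≢0)
    ... | yes rs≡0 = emptyAfterLast r c c<r (subst (_< c) (sym last≡0) a)
      where
      i0 : i ≡ 0
      i0 = cong (lastLabelled h) rs≡0
      prev≡0 : prevAGRow h r ≡ 0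
      prev≡0 = lastBelow-none (agRow h) (pred r) (λ t u v → trans (sym (Qf≡agRow t (subst (_< t) (sym i0) u) (≤-trans v (≤-trans pred[n]≤n rN))))
                 (lastBelow-max Qf (pred r) t (subst (_< t) (sym p0) u) v))
      last≡0 : lastLabelled h r ≡ 0
      last≡0 with overhang-false r (agRow-h r i<r rN sel) (no-overhang-above-rs r (subst (_< r) (sym rs≡0) (≤-<-trans z≤n i<r)) rN)
      ... | inj₁ x = ⊥-elim (n≮0 (subst (lastLabelled h r <_) prev≡0 x))
      ... | inj₂ x = x

    reinsert-eq : ∀ r c → 1 ≤ c → c ≤ r → r ≤ N → R′ r c ≡ h r c
    reinsert-eq r c a b rN with view r c a b rN
    ... | vBelow r<i e = trans e (trans (f₀-eq r c a b (≤-trans (<⇒≤ r<i) i≤n)) (unshift-fixed N h r c (<⇒≢ r<i) (inj₁ (<-asym r<i))))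
    ... | vDiag refl refl e = trans e (y≡ a)
    ... | vLeftOfDiag refl c<i e = trans e (sym (bdRowEmpty sth r c a c<i rN
                                     (notAG-between (1≤rs (≤-trans a (<⇒≤ c<i))) r ≤-refl (i<rs (1≤rs (≤-trans a (<⇒≤ c<i)))))))
    ... | vNonAG i<r skip e = trans e (trans (f₀-eq r c a b (Q→≤n r rN skip))
            (unshift-fixed N h r c (λ e → <-irrefl (sym e) i<r) (inj₂ (inj₁ (trans (sym (Qf≡agRow r i<r rN)) skip)))))
    ... | vAGDiag i<r sel refl e with r ≟ N
    ...   | yes refl = trans e (trans (addRow-top n z f₀) (sym top-z))
    ...   | no r≢ = trans e (trans (g-low r r rn) (trans (f₀-eq r r a ≤-refl rn)
                        (unshift-fixed N h r r (λ e → <-irrefl (sym e) i<r) (inj₂ (inj₂ ≤-refl)))))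
      where rn = ≤-pred (≤∧≢⇒< rN r≢)
    reinsert-eq r c a b rN | vShifted i<r sel c<r p1 c<p e = trans e (reinsert-shifted r c a i<r rN sel p1 c<p)
    reinsert-eq r c a b rN | vShiftedEmpty i<r sel c<r p1 p≤c e = trans e (sym (reinsert-shiftedEmpty r c i<r rN sel p1 p≤c c<r))
    reinsert-eq r c a b rN | vFirstEmpty i<r sel c<r p0 i<c e = trans e (sym (reinsert-firstEmpty r c a i<r rN sel p0 i<c c<r))
    reinsert-eq r c a b rN | vFirstShifted i<r sel c<r p0 c≤i e =
      trans e (trans (f₀-eq i c a c≤i i≤n) (trans (unshift-inserted N h c)
        (cong (λ w → h w c) (sym (first≡rs r i<r rN sel p0 (1≤rs (≤-trans a c≤i)))))))

insertionFun-BD : ∀ y n f r c → insertionFun n f (letter (bdSym y)) r c ≡ addRow n (bdSym y) f r c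
insertionFun-BD βᵧ n f r c = refl
insertionFun-BD δᵧ n f r c = refl

insertionFun-AG : ∀ x n f r c → insertionFun n f (letter (agSym x)) r c ≡ LetterShape.R n f (agSym x) (isAG-agSym x) r c
insertionFun-AG αₓ n f r c = refl
insertionFun-AG γₓ n f r c = refl

deletedFun-BD : ∀ y N h → deletedFun N h (just (bdSym y)) ≡ h
deletedFun-BD βᵧ N h = refl
deletedFun-BD δᵧ N h = refl

deletedElem-BD : ∀ y m h → deletedElem m h (just (bdSym y)) ≡ letter (bdSym y)
deletedElem-BD βᵧ m h = refl
deletedElem-BD δᵧ m h = refl

deletedFun-AG : ∀ x N h → deletedFun N h (just (agSym x)) ≡ unshift N h
deletedFun-AG αₓ N h = refl
deletedFun-AG γₓ N h = refl

deletedElem-AG : ∀ x m h → deletedElem m h (just (agSym x)) ≡ agElem m h x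
deletedElem-AG αₓ m h = refl
deletedElem-AG γₓ m h = refl

staircase-insertion : ∀ n (T₀ : Filling n) e → IsStaircase n T₀ → IsStaircase (suc n) (insertion T₀ e)
staircase-insertion n T₀ e st = staircase-build (suc n) _ (cases e)
  where
  f = get T₀
  stf = staircase-get n T₀ st
  cases : ∀ e → Staircase (suc n) (insertionFun n f e)
  cases (letter α) = Preservation.staircase-R n f α 0 β _ (LetterShape.shape n f α refl) refl refl z≤n stf
  cases (letter γ) = Preservation.staircase-R n f γ 0 β _ (LetterShape.shape n f γ refl) refl refl z≤n stf
  cases (letter β) = staircase-addRow n f β stf
  cases (letter δ) = staircase-addRow n f δ stf
  cases (triple x y k) = Preservation.staircase-R n f (agSym x) (suc (toℕ k)) (bdSym y) _ (TripleShape.shape n f x y k)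
                           (isAG-agSym x) (isAG-bdSym y) (TripleShape.i≤n n f x y k) stf

module DeleteInsert (m : ℕ) (T₀ : Filling (suc m)) (st : IsStaircase (suc m) T₀) where
  n = suc m
  N = suc n
  f = get T₀
  stf = staircase-get n T₀ st

  get-insertion : ∀ e r c → 1 ≤ c → c ≤ r → r ≤ N → get (insertion T₀ e) r c ≡ insertionFun n f e r c
  get-insertion e = get-build N (insertionFun n f e)

  delete-letterBD : ∀ y → deletion m (insertion T₀ (letter (bdSym y))) ≡ (T₀ , letter (bdSym y))
  delete-letterBD y = trans (deletion-top m _ (just (bdSym y)) top)
    (cong₂ _,_ (trans (cong (build n) (deletedFun-BD y N h)) (build-of-get n T₀ _ rows)) (deletedElem-BD y m h))
    where
    h = get (insertion T₀ (letter (bdSym y)))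
    top : h N N ≡ just (bdSym y)
    top = trans (get-insertion (letter (bdSym y)) N N (s≤s z≤n) ≤-refl ≤-refl) (trans (insertionFun-BD y n f N N) (addRow-top n (bdSym y) f))
    rows : ∀ r c → 1 ≤ c → c ≤ r → r ≤ n → h r c ≡ f r c
    rows r c a b rn = trans (get-insertion (letter (bdSym y)) r c a b (≤-trans rn (n≤1+n n)))
                        (trans (insertionFun-BD y n f r c) (addRow-low n (bdSym y) f r c (<⇒≢ (s≤s rn))))

  delete-letterAG : ∀ x → deletion m (insertion T₀ (letter (agSym x))) ≡ (T₀ , letter (agSym x))
  delete-letterAG x = trans (deletion-top m _ (just (agSym x)) I.top-diag)
    (cong₂ _,_ (trans (cong (build n) (deletedFun-AG x N h)) (build-of-get n T₀ _ I.unshift-recovers))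
               (trans (deletedElem-AG x m h) (agElem-letter m h x (I.overhangRow≡0 refl))))
    where
    h = get (insertion T₀ (letter (agSym x)))
    module I = LeftInverse n f (agSym x) 0 β _ (LetterShape.shape n f (agSym x) (isAG-agSym x)) (isAG-agSym x) z≤n stf h
                 (λ r c a b rn → trans (get-insertion (letter (agSym x)) r c a b rn) (insertionFun-AG x n f r c))

  delete-triple : ∀ x y k → deletion m (insertion T₀ (triple x y k)) ≡ (T₀ , triple x y k)
  delete-triple x y k = trans (deletion-top m _ (just (agSym x)) I.top-diag)
    (cong₂ _,_ (trans (cong (build n) (deletedFun-AG x N h)) (build-of-get n T₀ _ I.unshift-recovers))
               (trans (deletedElem-AG x m h) (trans (agElem-triple m h x overhangs) (cong₂ (triple x) label index))))
    where
    open TripleShape n f x y k using (i; i≤n; shape)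
    h = get (insertion T₀ (triple x y k))
    module I = LeftInverse n f (agSym x) i (bdSym y) _ shape (isAG-agSym x) i≤n stf h (get-insertion (triple x y k))
    overhangs : 1 ≤ overhangRow N h
    overhangs = subst (1 ≤_) (sym (I.overhangRow≡r0 (s≤s z≤n)))
                  (≤-<-trans z≤n (FirstAGAbove.i<r0 n (agSym x) f i (isAG-agSym x) i≤n))
    label : toBD (h (insertedRow N h) (insertedRow N h)) ≡ y
    label = begin
      toBD (h (insertedRow N h) (insertedRow N h)) ≡⟨ cong (λ w → toBD (h w w)) I.insertedRow≡i ⟩
      toBD (h i i)                                 ≡⟨ cong toBD (get-insertion (triple x y k) i i (s≤s z≤n) ≤-refl (≤-trans i≤n (n≤1+n n))) ⟩
      toBD (insertionFun n f (triple x y k) i i)   ≡⟨ cong toBD (InsertionShape.diag shape (s≤s z≤n)) ⟩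
      toBD (just (bdSym y))                        ≡⟨ toBD-bdSym y ⟩
      y                                            ∎
      where open ≡-Reasoning
    index : clamp m (insertedRow N h ∸ 1) ≡ k
    index = trans (cong (λ w → clamp m (w ∸ 1)) I.insertedRow≡i) (clamp-toℕ m k)

  deletion-insertion : ∀ e → deletion m (insertion T₀ e) ≡ (T₀ , e)
  deletion-insertion (letter α) = delete-letterAG αₓ
  deletion-insertion (letter γ) = delete-letterAG γₓ
  deletion-insertion (letter β) = delete-letterBD βᵧ
  deletion-insertion (letter δ) = delete-letterBD δᵧ
  deletion-insertion (triple x y k) = delete-triple x y k

-- Every staircase tableau T′ of size N = m+2 is an insertion into a staircase
-- tableau of size m+1: delete the top row if its diagonal is β/δ, otherwise
-- reinsert (the letter or triple read off T′) into unshift.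
module InsertionSurjective (m : ℕ) (T′ : Filling (suc (suc m))) (st′ : IsStaircase (suc (suc m)) T′) where
  n = suc m
  N = suc n
  h = get T′
  sth = staircase-get N T′ st′

  Preimage : Set
  Preimage = Σ (Filling n) λ T₀ → Σ (Elem n) λ e → IsStaircase n T₀ × (insertion T₀ e ≡ T′)

  preimage : ∀ T₀ e → IsStaircase n T₀ → (∀ r c → 1 ≤ c → c ≤ r → r ≤ N → insertionFun n (get T₀) e r c ≡ h r c) → Preimage
  preimage T₀ e st agree = T₀ , e , st , trans (build-cong N _ h agree) (build-get N T′)

  suc∸1 : ∀ i → 1 ≤ i → suc (i ∸ 1) ≡ i
  suc∸1 (suc i) _ = refl

  preimage-BD : ∀ y → h N N ≡ just (bdSym y) → Preimage
  preimage-BD y top = preimage (build n h) (letter (bdSym y)) (staircase-build n h (staircase-restrict n h sth)) agree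
    where
    f₀ = get (build n h)
    top-BD : IsBDLabel (h N N)
    top-BD = subst IsBDLabel (sym top) (notAG-bdLabel (just (bdSym y)) just≢nothing (isAG-bdSym y))
    agree : ∀ r c → 1 ≤ c → c ≤ r → r ≤ N → insertionFun n f₀ (letter (bdSym y)) r c ≡ h r c
    agree r c a b rN with r ≟ N
    ... | yes refl with c ≟ N
    ...   | yes refl = trans (insertionFun-BD y n f₀ N N) (trans (addRow-top n (bdSym y) f₀) (sym top))
    ...   | no c≢ = trans (insertionFun-BD y n f₀ N c) (trans (addRow-topOff n (bdSym y) f₀ c c≢)
                      (sym (Staircase.leftOfBD sth N N (s≤s z≤n) ≤-refl ≤-refl top-BD c a (≤∧≢⇒< b c≢))))
    agree r c a b rN | no r≢ = trans (insertionFun-BD y n f₀ r c) (trans (addRow-low n (bdSym y) f₀ r c r≢)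
                                 (get-build n h r c a b (≤-pred (≤∧≢⇒< rN r≢))))

  preimage-AG : ∀ x → h N N ≡ just (agSym x) → Preimage
  preimage-AG x top with overhangRow N h ≟ 0
  ... | yes rs≡0 = preimage (build n U.unshifted) (letter (agSym x)) st₀ R.reinsert-eq
    where
    module U = Unshifting n h sth (agSym x) (isAG-agSym x) top
    st₀ = staircase-build n U.unshifted U.staircase-unshifted
    i≡0 : U.i ≡ 0
    i≡0 = cong (lastLabelled h) rs≡0
    R′ = insertionFun n U.f₀ (letter (agSym x))
    shape : InsertionShape n U.f₀ (agSym x) U.i β R′
    shape = subst (λ j → InsertionShape n U.f₀ (agSym x) j β R′) (sym i≡0)
              (InsertionShape-ext (λ r c → sym (insertionFun-AG x n U.f₀ r c)) (LetterShape.shape n U.f₀ (agSym x) (isAG-agSym x)))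
    module R = U.Reinsert β R′ shape (λ 1≤i → ⊥-elim (<-irrefl (sym i≡0) 1≤i))
  ... | no rs≢0 = preimage (build n U.unshifted) (triple x y k) st₀ R.reinsert-eq
    where
    module U = Unshifting n h sth (agSym x) (isAG-agSym x) top
    st₀ = staircase-build n U.unshifted U.staircase-unshifted
    1≤i : 1 ≤ U.i
    1≤i = proj₂ (proj₂ (U.rs-overhangs (n≢0⇒n>0 rs≢0)))
    y = toBD (h U.i U.i)
    k = clamp m (U.i ∸ 1)
    k≡i : suc (toℕ k) ≡ U.i
    k≡i = trans (cong suc (toℕ-clamp m (U.i ∸ 1) (∸-monoˡ-≤ 1 U.i≤n))) (suc∸1 U.i 1≤i)
    R′ = insertionFun n U.f₀ (triple x y k)
    shape : InsertionShape n U.f₀ (agSym x) U.i (bdSym y) R′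
    shape = subst (λ j → InsertionShape n U.f₀ (agSym x) j (bdSym y) R′) k≡i (TripleShape.shape n U.f₀ x y k)
    module R = U.Reinsert (bdSym y) R′ shape (λ 1≤i′ → bd-toBD (U.diag-i-BD (U.1≤rs 1≤i′)))

  insertion-surjective : Preimage
  insertion-surjective = byTop (h N N) refl
    where
    byTop : (c : Cell) → h N N ≡ c → Preimage
    byTop nothing e = ⊥-elim (Staircase.diagFull sth N (s≤s z≤n) ≤-refl e)
    byTop (just α) e = preimage-AG αₓ e
    byTop (just γ) e = preimage-AG γₓ e
    byTop (just β) e = preimage-BD βᵧ e
    byTop (just δ) e = preimage-BD δᵧ e

theorem6 : (n : ℕ) → 1 ≤ n →
    ((T : Filling n) (e : Elem n) → IsStaircase n T → IsStaircase (suc n) (insertion T e))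
    × ((T₁ T₂ : Filling n) (e₁ e₂ : Elem n) → IsStaircase n T₁ → IsStaircase n T₂ →
    insertion T₁ e₁ ≡ insertion T₂ e₂ → (T₁ ≡ T₂) × (e₁ ≡ e₂))
    × ((T′ : Filling (suc n)) → IsStaircase (suc n) T′ →
    Σ (Filling n) λ T → Σ (Elem n) λ e → IsStaircase n T × (insertion T e ≡ T′))
theorem6 (suc m) _ = staircase-insertion (suc m) , injective , InsertionSurjective.insertion-surjective m
  where
  injective : (T₁ T₂ : Filling (suc m)) (e₁ e₂ : Elem (suc m)) → IsStaircase (suc m) T₁ → IsStaircase (suc m) T₂ →
              insertion T₁ e₁ ≡ insertion T₂ e₂ → (T₁ ≡ T₂) × (e₁ ≡ e₂)
  injective T₁ T₂ e₁ e₂ st₁ st₂ same = cong proj₁ pairs , cong proj₂ pairs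
    where
    open ≡-Reasoning
    pairs : (T₁ , e₁) ≡ (T₂ , e₂)
    pairs = begin
      (T₁ , e₁)                    ≡⟨ sym (DeleteInsert.deletion-insertion m T₁ st₁ e₁) ⟩
      deletion m (insertion T₁ e₁) ≡⟨ cong (deletion m) same ⟩
      deletion m (insertion T₂ e₂) ≡⟨ DeleteInsert.deletion-insertion m T₂ st₂ e₂ ⟩
      (T₂ , e₂)                    ∎
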